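{- Let $\pi$ be a permutation of $[n]$ and let $L, L'$ be two cyclic ladder lotteries in $\mathcal{L}^1(\pi)$. Then $\mathit{DV}(L)=\mathit{DV}(L')$ if and only if $L$ and $L'$ are reachable from each other under braid relations, i.e. there is a reconfiguration sequence under braid relations between $L$ and $L'$.
   Context: Let $[n]=\{1,\dots,n\}$ and let $\pi=(\pi_1,\dots,\pi_n)$ be a permutation of $[n]$. A cyclic ladder lottery $L$ of $\pi$ consists of $n$ vertical lines (line $1,\dots,n$ from left to right) and finitely many horizontal bars at distinct heights. Each bar connects two cyclically adjacent lines: lines $k$ and $k+1$ for some $1\le k\le n-1$, or lines $n$ and $1$. Place element $i$ at the top of line $i$ and sweep downward; each bar swaps the two elements currently on its lines. It is required that at the bottom, line $j$ carries $\pi_j$ for every $j$. The route of element $i$ is the pseudoline $\mathrm{pl}(L,i)$. Drawing the lines on a cylinder (so that lines $n$ and $1$ are adjacent), $L$ is an arrangement of $n$ $y$-monotone pseudolines on the cylinder, and each bar is an intersection point of two pseudolines. Cyclic ladder lotteries are regarded as pseudoline arrangements, i.e. identified when along every pseudoline the same pseudolines are crossed in the same order. $\mathcal{L}^1(\pi)$ is the set of cyclic ladder lotteries of $\pi$ in which any two pseudolines cross at most once. The displacement vector $\mathit{DV}(L)=(x_1,\dots,x_n)\in\mathbb{Z}^n$ is defined as follows. $x_i$ is the number of bars at which element $i$ moves one line to the right (from line $k$ to $k+1$, or from line $n$ to line $1$), minus the number of bars at which it moves one line to the left. Let $L\in\mathcal{L}^1(\pi)$. For distinct $i,j,k$, the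 triple $\{i,j,k\}$ is tangled if the three pseudolines pairwise cross. Restricting to these three pseudolines, let $p$ be the intersection adjacent to two top endpoints, $q$ the intersection adjacent to one top and one bottom endpoint, and $r$ the intersection adjacent to two bottom endpoints. The triple is left tangled if $p,q,r$ appear in counterclockwise order on the boundary of the region enclosed by the three pseudolines, and right tangled if they appear in clockwise order. A tangled triple is minimal if that region contains no part of any other pseudoline of $L$. A braid relation transforms a minimal left tangled triple into a minimal right tangled triple, or vice versa, by passing one of the three pseudolines across the intersection of the other two. In terms of bars, this replaces three consecutive bars on lines $k,k+1$, then $k+1,k+2$, then $k,k+1$ by bars on $k+1,k+2$, then $k,k+1$, then $k+1,k+2$ (indices mod $n$), or the reverse. A reconfiguration sequence under braid relations between $L$ and $L'$ is a sequence $L=L_0,L_1,\dots,L_t=L'$ in which each $L_{s}$ is obtained from $L_{s-1}$ by one braid relation. -}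

module Defs where

open import Data.Nat using (ℕ; zero; suc; _+_; _≤_; NonZero)
open import Data.Nat.DivMod using (_mod_)
open import Data.Integer as ℤ using (ℤ; +_; -[1+_])
open import Data.Fin using (Fin; toℕ; _≟_)
open import Data.Fin.Permutation using (Permutation′; _⟨$⟩ʳ_)
open import Data.List using (List; []; _∷_; _++_)
open import Data.Vec using (Vec; tabulate)
open import Data.Product using (_×_; _,_)
open import Data.Sum using (_⊎_)
open import Relation.Nullary using (yes; no; ¬_)
open import Relation.Binary.PropositionalEquality using (_≡_)
open import Relation.Binary.Construct.Closure.ReflexiveTransitive using (Star)

-- Lines and elements are indexed 0..n-1 (line k of the paper is `k-1`).
-- A cyclic ladder lottery is the list of its bars, from top to bottom;
-- the bar `k : Fin n` connects line k and line (k+1 mod n).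
Ladder : ℕ → Set
Ladder n = List (Fin n)

next : ∀ {n} → Fin n → Fin n
next {suc m} k = (suc (toℕ k)) mod (suc m)

-- a state assigns to each line the element currently on it
State : ℕ → Set
State n = Fin n → Fin n

swapAt : ∀ {n} → Fin n → State n → State n
swapAt k σ l with l ≟ k
... | yes _ = σ (next k)
... | no _ with l ≟ next k
...   | yes _ = σ k
...   | no _ = σ l

run : ∀ {n} → Ladder n → State n → State n
run [] σ = σ
run (k ∷ L) σ = run L (swapAt k σ)

-- the crossings, top to bottom: (a , b) means at this bar element a moves
-- one line to the right (line k to next k) and element b moves one line left
events : ∀ {n} → Ladder n → State n → List (Fin n × Fin n)
events [] σ = []
events (k ∷ L) σ = (σ k , σ (next k)) ∷ events L (swapAt k σ)

initial : ∀ {n} → State n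
initial l = l

IsLadderOf : ∀ {n} → Permutation′ n → Ladder n → Set
IsLadderOf π L = ∀ j → run L initial j ≡ π ⟨$⟩ʳ j

crossCount : ∀ {n} → List (Fin n × Fin n) → Fin n → Fin n → ℕ
crossCount [] i j = 0
crossCount ((a , b) ∷ es) i j with a ≟ i | b ≟ j | a ≟ j | b ≟ i
... | yes _ | yes _ | _ | _ = suc (crossCount es i j)
... | _ | _ | yes _ | yes _ = suc (crossCount es i j)
... | _ | _ | _ | _ = crossCount es i j

InL1 : ∀ {n} → Permutation′ n → Ladder n → Set
InL1 π L = IsLadderOf π L × (∀ i j → ¬ (i ≡ j) → crossCount (events L initial) i j ≤ 1)

crossSeqE : ∀ {n} → List (Fin n × Fin n) → Fin n → List (Fin n)
crossSeqE [] i = []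
crossSeqE ((a , b) ∷ es) i with a ≟ i
... | yes _ = b ∷ crossSeqE es i
... | no _ with b ≟ i
...   | yes _ = a ∷ crossSeqE es i
...   | no _ = crossSeqE es i

crossSeq : ∀ {n} → Ladder n → Fin n → List (Fin n)
crossSeq L = crossSeqE (events L initial)

-- identification as pseudoline arrangements
_≈A_ : ∀ {n} → Ladder n → Ladder n → Set
L ≈A L' = ∀ i → crossSeq L i ≡ crossSeq L' i

dispE : ∀ {n} → List (Fin n × Fin n) → Fin n → ℤ
dispE [] i = + 0
dispE ((a , b) ∷ es) i with a ≟ i
... | yes _ = + 1 ℤ.+ dispE es i
... | no _ with b ≟ i
...   | yes _ = -[1+ 0 ] ℤ.+ dispE es i
...   | no _ = dispE es i

DV : ∀ {n} → Ladder n → Vec ℤ n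
DV L = tabulate (dispE (events L initial))

data Braid {n : ℕ} : Ladder n → Ladder n → Set where
  braidₗ : ∀ (xs ys : Ladder n) (k : Fin n) →
    Braid (xs ++ k ∷ next k ∷ k ∷ ys) (xs ++ next k ∷ k ∷ next k ∷ ys)
  braidᵣ : ∀ (xs ys : Ladder n) (k : Fin n) →
    Braid (xs ++ next k ∷ k ∷ next k ∷ ys) (xs ++ k ∷ next k ∷ k ∷ ys)

-- a braid relation applied to the arrangement (lotteries taken up to ≈A)
Step : ∀ {n} → Ladder n → Ladder n → Set
Step L L' = L ≈A L' ⊎ Braid L L'

BraidReachable : ∀ {n} → Ladder n → Ladder n → Set
BraidReachable = Star Step

-- Follow every element along the ladder, recording its line ρ and its winding number W
-- (net passages over the seam between line n and line 1); then ρ + n·W is its position on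
-- the universal cover of the cylinder and its displacement is the change of that position.
-- For two elements i, j the potential W i − W j − [ρ i < ρ j] changes at each bar exactly
-- by the signed crossing of i and j. So two lotteries of π with the same displacement
-- vector have the same signed crossing number for every pair. When pseudolines meet at most
-- once these numbers determine the lottery up to commutations and braid relations: the pair
-- crossing at the first bar of L also crosses in L′, and its crossing can be moved to the
-- front of L′, commuting past disjoint bars and using a braid relation past an adjacent
-- one; three elements on consecutive lines have cyclic orientation −1, which makes such
-- crossings transitive. Conversely, a braid relation keeps all crossing counts, and
-- arrangements with equal crossing sequences have equal displacements, since their first
-- bars can be commuted together.

module Submission where

open import Defs
open import Algebra.Bundles using (AbelianGroup)
open import Data.Nat as ℕ using (ℕ; zero; suc; _≤_; _<_; z≤n; s≤s)
import Data.Nat.Properties as ℕP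
open import Data.Nat.DivMod using (_%_; m%n<n; m<n⇒m%n≡m; n%n≡0)
open import Data.Integer as ℤ using (ℤ; +_; -_; -[1+_]; _+_; _-_; _*_)
import Data.Integer.Properties as ℤP
open import Data.Integer.Tactic.RingSolver using (solve-∀)
open import Data.Fin using (Fin; toℕ; _≟_)
import Data.Fin.Properties as FP
open import Data.Fin.Permutation using (Permutation′)
open import Data.List using (List; []; _∷_; _++_; [_]; length)
import Data.List.Properties as LP
open import Data.Vec using (lookup)
import Data.Vec.Properties as VP
open import Data.List.Relation.Unary.All using (All; []; _∷_)
open import Data.Product using (_×_; _,_; proj₁; proj₂; ∃)
open import Data.Sum using (_⊎_; inj₁; inj₂)
open import Data.Empty using (⊥-elim)
open import Function using (Injective)
open import Function.Bundles using (_⇔_; mk⇔)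
open import Relation.Nullary using (yes; no; ¬_; Dec)
open import Relation.Binary.PropositionalEquality hiding ([_])
open import Relation.Binary.Construct.Closure.ReflexiveTransitive as Star
  using (Star; ε; _◅_; _◅◅_; gmap)

open import Algebra.Properties.Group (AbelianGroup.group ℤP.+-0-abelianGroup)
  using (∙-cancelˡ; ∙-cancelʳ)

module Cylinder (m : ℕ) (2≤m : 2 ≤ m) where

  N : ℕ
  N = suc m

  data NextView (k : Fin N) : Set where
    inner : toℕ k < m → toℕ (next k) ≡ suc (toℕ k) → NextView k
    seam  : toℕ k ≡ m → toℕ (next k) ≡ 0 → NextView k

  toℕ-next : ∀ k → toℕ (next k) ≡ suc (toℕ k) % N
  toℕ-next k = FP.toℕ-fromℕ< (m%n<n (suc (toℕ k)) N)

  nextView : ∀ k → NextView k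
  nextView k with toℕ k ℕ.<? m
  ... | yes k<m = inner k<m (trans (toℕ-next k) (m<n⇒m%n≡m (s≤s k<m)))
  ... | no k≮m = seam k≡m (trans (toℕ-next k) (subst (λ x → suc x % N ≡ 0) (sym k≡m) (n%n≡0 N)))
    where
    k≡m : toℕ k ≡ m
    k≡m = ℕP.≤-antisym (ℕP.≤-pred (FP.toℕ<n k)) (ℕP.≮⇒≥ k≮m)

  m≢0 : m ≢ 0
  m≢0 m≡0 with () ← subst (2 ≤_) m≡0 2≤m

  m≢1 : m ≢ 1
  m≢1 m≡1 with s≤s () ← subst (2 ≤_) m≡1 2≤m

  next≢self : ∀ k → next k ≢ k
  next≢self k eq with nextView k
  ... | inner _ q = ℕP.1+n≢n (trans (sym q) (cong toℕ eq))
  ... | seam p q  = m≢0 (trans (sym p) (trans (sym (cong toℕ eq)) q))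

  self≢next : ∀ k → k ≢ next k
  self≢next k = ≢-sym (next≢self k)

  next-injective : ∀ {k l} → next k ≡ next l → k ≡ l
  next-injective {k} {l} eq with nextView k | nextView l
  ... | inner _ q | inner _ r =
    FP.toℕ-injective (ℕP.suc-injective (trans (sym q) (trans (cong toℕ eq) r)))
  ... | inner _ q | seam _ r with () ← trans (sym q) (trans (cong toℕ eq) r)
  ... | seam _ q | inner _ r with () ← trans (sym r) (trans (sym (cong toℕ eq)) q)
  ... | seam p _ | seam p′ _ = FP.toℕ-injective (trans p (sym p′))

  -- Needs 3 ≤ N: on a cylinder of two lines, next ∘ next is the identity.
  next²≢self : ∀ k → next (next k) ≢ k
  next²≢self k eq with nextView k | nextView (next k)
  ... | inner _ q | inner _ r =
    ℕP.m+1+n≢m (toℕ k) {1} (trans (ℕP.+-comm (toℕ k) 2) (trans (cong suc (sym q)) (trans (sym r) (cong toℕ eq))))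
  ... | inner _ q | seam p r = m≢1 (trans (sym p) (trans q (cong suc (trans (sym (cong toℕ eq)) r))))
  ... | seam p q | inner _ r = m≢1 (trans (sym p) (trans (sym (cong toℕ eq)) (trans r (cong suc q))))
  ... | seam _ q | seam p′ _ = m≢0 (trans (sym p′) q)

  swapAt-here : ∀ k (σ : State N) → swapAt k σ k ≡ σ (next k)
  swapAt-here k σ with k ≟ k
  ... | yes _ = refl
  ... | no k≢k = ⊥-elim (k≢k refl)

  swapAt-next : ∀ k (σ : State N) → swapAt k σ (next k) ≡ σ k
  swapAt-next k σ with next k ≟ k
  ... | yes eq = ⊥-elim (next≢self k eq)
  ... | no _ with next k ≟ next k
  ...   | yes _ = refl
  ...   | no ≢ = ⊥-elim (≢ refl)

  swapAt-other : ∀ k (σ : State N) {l} → l ≢ k → l ≢ next k → swapAt k σ l ≡ σ l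
  swapAt-other k σ {l} l≢k l≢nk with l ≟ k
  ... | yes eq = ⊥-elim (l≢k eq)
  ... | no _ with l ≟ next k
  ...   | yes eq = ⊥-elim (l≢nk eq)
  ...   | no _ = refl

  swapAt-cong : ∀ k {σ σ′ : State N} → σ ≗ σ′ → swapAt k σ ≗ swapAt k σ′
  swapAt-cong k h l with l ≟ k
  ... | yes _ = h _
  ... | no _ with l ≟ next k
  ...   | yes _ = h _
  ...   | no _ = h _

  data LineCase (k l : Fin N) : Set where
    at-bar   : l ≡ k → LineCase k l
    at-next  : l ≡ next k → LineCase k l
    off-bar  : l ≢ k → l ≢ next k → LineCase k l

  lineCase : ∀ k l → LineCase k l
  lineCase k l with l ≟ k
  ... | yes p = at-bar p
  ... | no p with l ≟ next k
  ...   | yes q = at-next q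
  ...   | no q = off-bar p q

  swapAt-injective : ∀ k {σ : State N} → Injective _≡_ _≡_ σ → Injective _≡_ _≡_ (swapAt k σ)
  swapAt-injective k {σ} inj {l} {l′} h with lineCase k l | lineCase k l′
  ... | at-bar refl  | at-bar refl  = refl
  ... | at-next refl | at-next refl = refl
  ... | at-bar refl  | at-next refl =
    ⊥-elim (next≢self k (inj (trans (sym (swapAt-here k σ)) (trans h (swapAt-next k σ)))))
  ... | at-next refl | at-bar refl  =
    ⊥-elim (next≢self k (inj (trans (sym (swapAt-here k σ)) (trans (sym h) (swapAt-next k σ)))))
  ... | at-bar refl  | off-bar p q  =
    ⊥-elim (q (sym (inj (trans (sym (swapAt-here k σ)) (trans h (swapAt-other k σ p q))))))
  ... | at-next refl | off-bar p q  =
    ⊥-elim (p (sym (inj (trans (sym (swapAt-next k σ)) (trans h (swapAt-other k σ p q))))))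
  ... | off-bar p q  | at-bar refl  =
    ⊥-elim (q (inj (trans (sym (swapAt-other k σ p q)) (trans h (swapAt-here k σ)))))
  ... | off-bar p q  | at-next refl =
    ⊥-elim (p (inj (trans (sym (swapAt-other k σ p q)) (trans h (swapAt-next k σ)))))
  ... | off-bar p q  | off-bar p′ q′ =
    inj (trans (sym (swapAt-other k σ p q)) (trans h (swapAt-other k σ p′ q′)))

  run-injective : ∀ L {σ : State N} → Injective _≡_ _≡_ σ → Injective _≡_ _≡_ (run L σ)
  run-injective [] h = h
  run-injective (k ∷ L) h = run-injective L (swapAt-injective k h)

  run-++ : ∀ (xs ys : Ladder N) σ → run (xs ++ ys) σ ≡ run ys (run xs σ)
  run-++ [] ys σ = refl
  run-++ (k ∷ xs) ys σ = run-++ xs ys (swapAt k σ)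

  events-++ : ∀ (xs ys : Ladder N) σ → events (xs ++ ys) σ ≡ events xs σ ++ events ys (run xs σ)
  events-++ [] ys σ = refl
  events-++ (k ∷ xs) ys σ = cong (_ ∷_) (events-++ xs ys (swapAt k σ))

  run-cong : ∀ (L : Ladder N) {σ σ′} → σ ≗ σ′ → run L σ ≗ run L σ′
  run-cong [] h = h
  run-cong (k ∷ L) h = run-cong L (swapAt-cong k h)

  events-cong : ∀ (L : Ladder N) {σ σ′} → σ ≗ σ′ → events L σ ≡ events L σ′
  events-cong [] h = refl
  events-cong (k ∷ L) h = cong₂ _∷_ (cong₂ _,_ (h k) (h (next k))) (events-cong L (swapAt-cong k h))

  -- σ is the state; ρ is its inverse (the line of each element) and W the winding
  -- number of each element: its net number of rightward passages over the seam bar.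
  record Tracker : Set where
    constructor tracker
    field
      σ : State N
      ρ : Fin N → Fin N
      W : Fin N → ℤ
  open Tracker public

  isSeam : Fin N → ℤ
  isSeam k with toℕ k ℕ.≟ m
  ... | yes _ = + 1
  ... | no _ = + 0

  isSeam-inner : ∀ k → toℕ k < m → isSeam k ≡ + 0
  isSeam-inner k k<m with toℕ k ℕ.≟ m
  ... | yes k≡m = ⊥-elim (ℕP.<-irrefl k≡m k<m)
  ... | no _ = refl

  isSeam-seam : ∀ k → toℕ k ≡ m → isSeam k ≡ + 1
  isSeam-seam k k≡m with toℕ k ℕ.≟ m
  ... | yes _ = refl
  ... | no k≢m = ⊥-elim (k≢m k≡m)

  stepρ : Fin N → State N → (Fin N → Fin N) → Fin N → Fin N
  stepρ k σ ρ x with x ≟ σ k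
  ... | yes _ = next k
  ... | no _ with x ≟ σ (next k)
  ...   | yes _ = k
  ...   | no _ = ρ x

  stepW : Fin N → State N → (Fin N → ℤ) → Fin N → ℤ
  stepW k σ W x with x ≟ σ k
  ... | yes _ = W x + isSeam k
  ... | no _ with x ≟ σ (next k)
  ...   | yes _ = W x - isSeam k
  ...   | no _ = W x

  step : Fin N → Tracker → Tracker
  step k s = tracker (swapAt k (σ s)) (stepρ k (σ s) (ρ s)) (stepW k (σ s) (W s))

  track : Ladder N → Tracker → Tracker
  track [] s = s
  track (k ∷ L) s = track L (step k s)

  σ-track : ∀ L s → σ (track L s) ≡ run L (σ s)
  σ-track [] s = refl
  σ-track (k ∷ L) s = σ-track L (step k s)

  Consistent : Tracker → Set
  Consistent s = (∀ l → ρ s (σ s l) ≡ l) × (∀ x → σ s (ρ s x) ≡ x)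

  module TrackerStep {s : Tracker} (c : Consistent s) where

    σ-injective : Injective _≡_ _≡_ (σ s)
    σ-injective {l} {l′} e = trans (sym (proj₁ c l)) (trans (cong (ρ s) e) (proj₁ c l′))

    σ-next≢σ : ∀ k → σ s (next k) ≢ σ s k
    σ-next≢σ k e = next≢self k (σ-injective e)

    ρ-left : ∀ k → stepρ k (σ s) (ρ s) (σ s k) ≡ next k
    ρ-left k with σ s k ≟ σ s k
    ... | yes _ = refl
    ... | no ≢ = ⊥-elim (≢ refl)

    ρ-right : ∀ k → stepρ k (σ s) (ρ s) (σ s (next k)) ≡ k
    ρ-right k with σ s (next k) ≟ σ s k
    ... | yes e = ⊥-elim (σ-next≢σ k e)
    ... | no _ with σ s (next k) ≟ σ s (next k)
    ...   | yes _ = refl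
    ...   | no ≢ = ⊥-elim (≢ refl)

    ρ-other : ∀ k {x} → x ≢ σ s k → x ≢ σ s (next k) → stepρ k (σ s) (ρ s) x ≡ ρ s x
    ρ-other k {x} p q with x ≟ σ s k
    ... | yes e = ⊥-elim (p e)
    ... | no _ with x ≟ σ s (next k)
    ...   | yes e = ⊥-elim (q e)
    ...   | no _ = refl

    W-left : ∀ k → stepW k (σ s) (W s) (σ s k) ≡ W s (σ s k) + isSeam k
    W-left k with σ s k ≟ σ s k
    ... | yes _ = refl
    ... | no ≢ = ⊥-elim (≢ refl)

    W-right : ∀ k → stepW k (σ s) (W s) (σ s (next k)) ≡ W s (σ s (next k)) - isSeam k
    W-right k with σ s (next k) ≟ σ s k
    ... | yes e = ⊥-elim (σ-next≢σ k e)
    ... | no _ with σ s (next k) ≟ σ s (next k)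
    ...   | yes _ = refl
    ...   | no ≢ = ⊥-elim (≢ refl)

    W-other : ∀ k {x} → x ≢ σ s k → x ≢ σ s (next k) → stepW k (σ s) (W s) x ≡ W s x
    W-other k {x} p q with x ≟ σ s k
    ... | yes e = ⊥-elim (p e)
    ... | no _ with x ≟ σ s (next k)
    ...   | yes e = ⊥-elim (q e)
    ...   | no _ = refl

    data ElementCase (k x : Fin N) : Set where
      left-end  : x ≡ σ s k → ElementCase k x
      right-end : x ≡ σ s (next k) → ElementCase k x
      elsewhere : x ≢ σ s k → x ≢ σ s (next k) → ρ s x ≢ k → ρ s x ≢ next k → ElementCase k x

    elementCase : ∀ k x → ElementCase k x
    elementCase k x with x ≟ σ s k
    ... | yes p = left-end p
    ... | no p with x ≟ σ s (next k)
    ...   | yes q = right-end q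
    ...   | no q = elsewhere p q (λ e → p (trans (sym (proj₂ c x)) (cong (σ s) e)))
                               (λ e → q (trans (sym (proj₂ c x)) (cong (σ s) e)))

    consistent-step : ∀ k → Consistent (step k s)
    consistent-step k = ρ∘σ , σ∘ρ
      where
      ρ∘σ : ∀ l → stepρ k (σ s) (ρ s) (swapAt k (σ s) l) ≡ l
      ρ∘σ l with lineCase k l
      ... | at-bar refl = trans (cong (stepρ k (σ s) (ρ s)) (swapAt-here k (σ s))) (ρ-right k)
      ... | at-next refl = trans (cong (stepρ k (σ s) (ρ s)) (swapAt-next k (σ s))) (ρ-left k)
      ... | off-bar p q = trans (cong (stepρ k (σ s) (ρ s)) (swapAt-other k (σ s) p q))
                           (trans (ρ-other k (λ e → p (σ-injective e)) (λ e → q (σ-injective e))) (proj₁ c l))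
      σ∘ρ : ∀ x → swapAt k (σ s) (stepρ k (σ s) (ρ s) x) ≡ x
      σ∘ρ x with elementCase k x
      ... | left-end refl = trans (cong (swapAt k (σ s)) (ρ-left k)) (swapAt-next k (σ s))
      ... | right-end refl = trans (cong (swapAt k (σ s)) (ρ-right k)) (swapAt-here k (σ s))
      ... | elsewhere p q p′ q′ =
        trans (cong (swapAt k (σ s)) (ρ-other k p q)) (trans (swapAt-other k (σ s) p′ q′) (proj₂ c x))

  consistent-track : ∀ L s → Consistent s → Consistent (track L s)
  consistent-track [] s c = c
  consistent-track (k ∷ L) s c = consistent-track L (step k s) (TrackerStep.consistent-step {s} c k)

  ltℤ : ℕ → ℕ → ℤ
  ltℤ x y with x ℕ.<? y
  ... | yes _ = + 1
  ... | no _ = + 0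

  ltℤ-yes : ∀ {x y} → x < y → ltℤ x y ≡ + 1
  ltℤ-yes {x} {y} x<y with x ℕ.<? y
  ... | yes _ = refl
  ... | no x≮y = ⊥-elim (x≮y x<y)

  ltℤ-no : ∀ {x y} → ¬ (x < y) → ltℤ x y ≡ + 0
  ltℤ-no {x} {y} x≮y with x ℕ.<? y
  ... | yes x<y = ⊥-elim (x≮y x<y)
  ... | no _ = refl

  ltℤ-sucˡ : ∀ x y → y ≢ suc x → ltℤ (suc x) y ≡ ltℤ x y
  ltℤ-sucˡ x y y≢1+x with x ℕ.<? y
  ... | yes x<y = ltℤ-yes (ℕP.≤∧≢⇒< x<y (≢-sym y≢1+x))
  ... | no x≮y = ltℤ-no (λ 1+x<y → x≮y (ℕP.<-trans (ℕP.n<1+n x) 1+x<y))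

  ltℤ-sucʳ : ∀ x y → y ≢ x → ltℤ y (suc x) ≡ ltℤ y x
  ltℤ-sucʳ x y y≢x with y ℕ.<? x
  ... | yes y<x = ltℤ-yes (ℕP.<-trans y<x (ℕP.n<1+n x))
  ... | no y≮x = ltℤ-no (λ y<1+x → y≮x (ℕP.≤∧≢⇒< (ℕP.≤-pred y<1+x) y≢x))

  before : Fin N → Fin N → ℤ
  before a b = ltℤ (toℕ a) (toℕ b)

  toℕ-≢ : ∀ {a b : Fin N} → a ≢ b → toℕ a ≢ toℕ b
  toℕ-≢ a≢b e = a≢b (FP.toℕ-injective e)

  toℕ≤m : ∀ (p : Fin N) → toℕ p ≤ m
  toℕ≤m p = ℕP.≤-pred (FP.toℕ<n p)

  module InnerBar (k : Fin N) (q : toℕ (next k) ≡ suc (toℕ k)) where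
    k-before-next : before k (next k) ≡ + 1
    k-before-next rewrite q = ltℤ-yes (ℕP.n<1+n (toℕ k))
    next-not-before-k : before (next k) k ≡ + 0
    next-not-before-k rewrite q = ltℤ-no (λ r → ℕP.<-asym r (ℕP.n<1+n (toℕ k)))
    next-before≡k-before : ∀ p → p ≢ next k → before (next k) p ≡ before k p
    next-before≡k-before p p≢nk rewrite q = ltℤ-sucˡ (toℕ k) (toℕ p) (λ e → toℕ-≢ p≢nk (trans e (sym q)))
    before-next≡before-k : ∀ p → p ≢ k → before p (next k) ≡ before p k
    before-next≡before-k p p≢k rewrite q = ltℤ-sucʳ (toℕ k) (toℕ p) (toℕ-≢ p≢k)

  module SeamBar (k : Fin N) (p0 : toℕ k ≡ m) (q : toℕ (next k) ≡ 0) where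
    k-not-before-next : before k (next k) ≡ + 0
    k-not-before-next rewrite q = ltℤ-no {toℕ k} {0} (λ ())
    next-before-k : before (next k) k ≡ + 1
    next-before-k rewrite q | p0 = ltℤ-yes (ℕP.n≢0⇒n>0 m≢0)
    next-before-others : ∀ p → p ≢ next k → before (next k) p ≡ + 1
    next-before-others p p≢nk rewrite q = ltℤ-yes (ℕP.n≢0⇒n>0 (λ e → toℕ-≢ p≢nk (trans e (sym q))))
    k-before-none : ∀ p → before k p ≡ + 0
    k-before-none p rewrite p0 = ltℤ-no (λ r → ℕP.<⇒≱ r (toℕ≤m p))
    none-before-next : ∀ p → before p (next k) ≡ + 0
    none-before-next p rewrite q = ltℤ-no {toℕ p} {0} (λ ())
    others-before-k : ∀ p → p ≢ k → before p k ≡ + 1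
    others-before-k p p≢k rewrite p0 = ltℤ-yes (ℕP.≤∧≢⇒< (toℕ≤m p) (λ e → toℕ-≢ p≢k (trans e (sym p0))))

  Events : Set
  Events = List (Fin N × Fin N)

  signedCross : Fin N × Fin N → Fin N → Fin N → ℤ
  signedCross (a , b) i j with a ≟ i | b ≟ j | a ≟ j | b ≟ i
  ... | yes _ | yes _ | _ | _ = + 1
  ... | _ | _ | yes _ | yes _ = -[1+ 0 ]
  ... | _ | _ | _ | _ = + 0

  signedCross-forward : ∀ i j → signedCross (i , j) i j ≡ + 1
  signedCross-forward i j with i ≟ i | j ≟ j | i ≟ j | j ≟ i
  ... | yes _ | yes _ | _ | _ = refl
  ... | no ≢ | _ | _ | _ = ⊥-elim (≢ refl)
  ... | _ | no ≢ | _ | _ = ⊥-elim (≢ refl)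

  signedCross-backward : ∀ i j → i ≢ j → signedCross (j , i) i j ≡ -[1+ 0 ]
  signedCross-backward i j i≢j with j ≟ i | i ≟ j | j ≟ j | i ≟ i
  ... | yes e | _ | _ | _ = ⊥-elim (i≢j (sym e))
  ... | _ | yes e | _ | _ = ⊥-elim (i≢j e)
  ... | no _ | no _ | yes _ | yes _ = refl
  ... | no _ | no _ | no ≢ | _ = ⊥-elim (≢ refl)
  ... | no _ | no _ | _ | no ≢ = ⊥-elim (≢ refl)

  signedCross-unrelated : ∀ (a b i j : Fin N) → ¬ (a ≡ i × b ≡ j) → ¬ (a ≡ j × b ≡ i) → signedCross (a , b) i j ≡ + 0
  signedCross-unrelated a b i j h₁ h₂ with a ≟ i | b ≟ j | a ≟ j | b ≟ i
  ... | yes p | yes q | _ | _ = ⊥-elim (h₁ (p , q))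
  ... | _ | _ | yes p | yes q = ⊥-elim (h₂ (p , q))
  ... | no _ | _ | no _ | _ = refl
  ... | no _ | _ | yes _ | no _ = refl
  ... | yes _ | no _ | no _ | _ = refl
  ... | yes _ | no _ | yes _ | no _ = refl

  signedCrossings : Events → Fin N → Fin N → ℤ
  signedCrossings [] i j = + 0
  signedCrossings (e ∷ es) i j = signedCross e i j + signedCrossings es i j

  -- The potential of (i , j) is ⌊(lift s i - lift s j) / N⌋ (see lift below): the number
  -- of full turns by which i is ahead of j on the universal cover of the cylinder.
  potential : Tracker → Fin N → Fin N → ℤ
  potential s i j = W s i - W s j - before (ρ s i) (ρ s j)

  module PotentialStep {s : Tracker} (c : Consistent s) (k : Fin N) where
    open TrackerStep {s} c

    private
      a = σ s k
      b = σ s (next k)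
      s′ = step k s

    left-right : potential s′ a b ≡ potential s a b + signedCross (a , b) a b
    left-right with nextView k
    ... | inner p q
      rewrite W-left k | W-right k | ρ-left k | ρ-right k | proj₁ c k | proj₁ c (next k)
            | InnerBar.k-before-next k q | InnerBar.next-not-before-k k q | isSeam-inner k p | signedCross-forward a b
      = ring (W s a) (W s b)
      where
      ring : ∀ x y → (x + + 0) - (y - + 0) - + 0 ≡ (x - y - + 1) + + 1
      ring = solve-∀
    ... | seam p q
      rewrite W-left k | W-right k | ρ-left k | ρ-right k | proj₁ c k | proj₁ c (next k)
            | SeamBar.k-not-before-next k p q | SeamBar.next-before-k k p q | isSeam-seam k p | signedCross-forward a b
      = ring (W s a) (W s b)
      where
      ring : ∀ x y → (x + + 1) - (y - + 1) - + 1 ≡ (x - y - + 0) + + 1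
      ring = solve-∀

    right-left : potential s′ b a ≡ potential s b a + signedCross (a , b) b a
    right-left with nextView k
    ... | inner p q
      rewrite W-left k | W-right k | ρ-left k | ρ-right k | proj₁ c k | proj₁ c (next k)
            | InnerBar.k-before-next k q | InnerBar.next-not-before-k k q | isSeam-inner k p
            | signedCross-backward b a (σ-next≢σ k)
      = ring (W s a) (W s b)
      where
      ring : ∀ x y → (y - + 0) - (x + + 0) - + 1 ≡ (y - x - + 0) + -[1+ 0 ]
      ring = solve-∀
    ... | seam p q
      rewrite W-left k | W-right k | ρ-left k | ρ-right k | proj₁ c k | proj₁ c (next k)
            | SeamBar.k-not-before-next k p q | SeamBar.next-before-k k p q | isSeam-seam k p
            | signedCross-backward b a (σ-next≢σ k)
      = ring (W s a) (W s b)
      where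
      ring : ∀ x y → (y - + 1) - (x + + 1) - + 0 ≡ (y - x - + 1) + -[1+ 0 ]
      ring = solve-∀

    left-other : ∀ j → j ≢ a → j ≢ b → ρ s j ≢ next k →
                 potential s′ a j ≡ potential s a j + signedCross (a , b) a j
    left-other j j≢a j≢b ρj≢nk with nextView k
    ... | inner p q
      rewrite W-left k | W-other k j≢a j≢b | ρ-left k | ρ-other k j≢a j≢b | proj₁ c k
            | InnerBar.next-before≡k-before k q (ρ s j) ρj≢nk | isSeam-inner k p
            | signedCross-unrelated a b a j (λ (_ , e) → j≢b (sym e)) (λ (e , _) → j≢a (sym e))
      = ring (W s a) (W s j) (before k (ρ s j))
      where
      ring : ∀ x z L → (x + + 0) - z - L ≡ (x - z - L) + + 0
      ring = solve-∀
    ... | seam p q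
      rewrite W-left k | W-other k j≢a j≢b | ρ-left k | ρ-other k j≢a j≢b | proj₁ c k
            | SeamBar.next-before-others k p q (ρ s j) ρj≢nk | SeamBar.k-before-none k p q (ρ s j) | isSeam-seam k p
            | signedCross-unrelated a b a j (λ (_ , e) → j≢b (sym e)) (λ (e , _) → j≢a (sym e))
      = ring (W s a) (W s j)
      where
      ring : ∀ x z → (x + + 1) - z - + 1 ≡ (x - z - + 0) + + 0
      ring = solve-∀

    right-other : ∀ j → j ≢ a → j ≢ b → ρ s j ≢ next k →
                  potential s′ b j ≡ potential s b j + signedCross (a , b) b j
    right-other j j≢a j≢b ρj≢nk with nextView k
    ... | inner p q
      rewrite W-right k | W-other k j≢a j≢b | ρ-right k | ρ-other k j≢a j≢b | proj₁ c (next k)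
            | InnerBar.next-before≡k-before k q (ρ s j) ρj≢nk | isSeam-inner k p
            | signedCross-unrelated a b b j (λ (e , _) → σ-next≢σ k (sym e)) (λ (e , _) → j≢a (sym e))
      = ring (W s b) (W s j) (before k (ρ s j))
      where
      ring : ∀ y z L → (y - + 0) - z - L ≡ (y - z - L) + + 0
      ring = solve-∀
    ... | seam p q
      rewrite W-right k | W-other k j≢a j≢b | ρ-right k | ρ-other k j≢a j≢b | proj₁ c (next k)
            | SeamBar.next-before-others k p q (ρ s j) ρj≢nk | SeamBar.k-before-none k p q (ρ s j) | isSeam-seam k p
            | signedCross-unrelated a b b j (λ (e , _) → σ-next≢σ k (sym e)) (λ (e , _) → j≢a (sym e))
      = ring (W s b) (W s j)
      where
      ring : ∀ y z → (y - + 1) - z - + 0 ≡ (y - z - + 1) + + 0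
      ring = solve-∀

    other-left : ∀ i → i ≢ a → i ≢ b → ρ s i ≢ k →
                 potential s′ i a ≡ potential s i a + signedCross (a , b) i a
    other-left i i≢a i≢b ρi≢k with nextView k
    ... | inner p q
      rewrite W-left k | W-other k i≢a i≢b | ρ-left k | ρ-other k i≢a i≢b | proj₁ c k
            | InnerBar.before-next≡before-k k q (ρ s i) ρi≢k | isSeam-inner k p
            | signedCross-unrelated a b i a (λ (e , _) → i≢a (sym e)) (λ (_ , e) → i≢b (sym e))
      = ring (W s a) (W s i) (before (ρ s i) k)
      where
      ring : ∀ x z L → z - (x + + 0) - L ≡ (z - x - L) + + 0
      ring = solve-∀
    ... | seam p q
      rewrite W-left k | W-other k i≢a i≢b | ρ-left k | ρ-other k i≢a i≢b | proj₁ c k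
            | SeamBar.none-before-next k p q (ρ s i) | SeamBar.others-before-k k p q (ρ s i) ρi≢k | isSeam-seam k p
            | signedCross-unrelated a b i a (λ (e , _) → i≢a (sym e)) (λ (_ , e) → i≢b (sym e))
      = ring (W s a) (W s i)
      where
      ring : ∀ x z → z - (x + + 1) - + 0 ≡ (z - x - + 1) + + 0
      ring = solve-∀

    other-right : ∀ i → i ≢ a → i ≢ b → ρ s i ≢ k →
                  potential s′ i b ≡ potential s i b + signedCross (a , b) i b
    other-right i i≢a i≢b ρi≢k with nextView k
    ... | inner p q
      rewrite W-right k | W-other k i≢a i≢b | ρ-right k | ρ-other k i≢a i≢b | proj₁ c (next k)
            | InnerBar.before-next≡before-k k q (ρ s i) ρi≢k | isSeam-inner k p
            | signedCross-unrelated a b i b (λ (e , _) → i≢a (sym e)) (λ (e , _) → σ-next≢σ k (sym e))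
      = ring (W s b) (W s i) (before (ρ s i) k)
      where
      ring : ∀ y z L → z - (y - + 0) - L ≡ (z - y - L) + + 0
      ring = solve-∀
    ... | seam p q
      rewrite W-right k | W-other k i≢a i≢b | ρ-right k | ρ-other k i≢a i≢b | proj₁ c (next k)
            | SeamBar.none-before-next k p q (ρ s i) | SeamBar.others-before-k k p q (ρ s i) ρi≢k | isSeam-seam k p
            | signedCross-unrelated a b i b (λ (e , _) → i≢a (sym e)) (λ (e , _) → σ-next≢σ k (sym e))
      = ring (W s b) (W s i)
      where
      ring : ∀ y z → z - (y - + 1) - + 1 ≡ (z - y - + 0) + + 0
      ring = solve-∀

    others : ∀ i j → i ≢ a → i ≢ b → j ≢ a → j ≢ b →
             potential s′ i j ≡ potential s i j + signedCross (a , b) i j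
    others i j i≢a i≢b j≢a j≢b
      rewrite W-other k i≢a i≢b | W-other k j≢a j≢b | ρ-other k i≢a i≢b | ρ-other k j≢a j≢b
            | signedCross-unrelated a b i j (λ (e , _) → i≢a (sym e)) (λ (e , _) → j≢a (sym e))
      = sym (ℤP.+-identityʳ _)

    potential-step : ∀ i j → i ≢ j → potential s′ i j ≡ potential s i j + signedCross (a , b) i j
    potential-step i j i≢j with elementCase k i | elementCase k j
    ... | left-end refl  | left-end refl  = ⊥-elim (i≢j refl)
    ... | right-end refl | right-end refl = ⊥-elim (i≢j refl)
    ... | left-end refl  | right-end refl = left-right
    ... | right-end refl | left-end refl  = right-left
    ... | left-end refl  | elsewhere j≢a j≢b _ ρj≢nk = left-other j j≢a j≢b ρj≢nk
    ... | right-end refl | elsewhere j≢a j≢b _ ρj≢nk = right-other j j≢a j≢b ρj≢nk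
    ... | elsewhere i≢a i≢b ρi≢k _ | left-end refl  = other-left i i≢a i≢b ρi≢k
    ... | elsewhere i≢a i≢b ρi≢k _ | right-end refl = other-right i i≢a i≢b ρi≢k
    ... | elsewhere i≢a i≢b _ _ | elsewhere j≢a j≢b _ _ = others i j i≢a i≢b j≢a j≢b

  potential-track : ∀ L s → Consistent s → ∀ i j → i ≢ j →
                    potential (track L s) i j ≡ potential s i j + signedCrossings (events L (σ s)) i j
  potential-track [] s c i j i≢j = sym (ℤP.+-identityʳ _)
  potential-track (k ∷ L) s c i j i≢j = begin
    potential (track L (step k s)) i j
      ≡⟨ potential-track L (step k s) (TrackerStep.consistent-step {s} c k) i j i≢j ⟩
    potential (step k s) i j + signedCrossings (events L (swapAt k (σ s))) i j
      ≡⟨ cong (_+ signedCrossings (events L (swapAt k (σ s))) i j) (PotentialStep.potential-step {s} c k i j i≢j) ⟩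
    potential s i j + signedCross (σ s k , σ s (next k)) i j + signedCrossings (events L (swapAt k (σ s))) i j
      ≡⟨ ℤP.+-assoc (potential s i j) _ _ ⟩
    potential s i j + signedCrossings (events (k ∷ L) (σ s)) i j ∎
    where open ≡-Reasoning

  orientation : ℕ → ℕ → ℕ → ℤ
  orientation x y z = ltℤ x z - ltℤ x y - ltℤ y z

  orientation-values : ∀ x y z → orientation x y z ≡ + 0 ⊎ orientation x y z ≡ -[1+ 0 ]
  orientation-values x y z with x ℕ.<? y | y ℕ.<? z | x ℕ.<? z
  ... | yes _ | yes _ | yes _ = inj₂ refl
  ... | yes p | yes q | no r = ⊥-elim (r (ℕP.<-trans p q))
  ... | yes _ | no _ | yes _ = inj₁ refl
  ... | yes _ | no _ | no _ = inj₂ refl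
  ... | no _ | yes _ | yes _ = inj₁ refl
  ... | no _ | yes _ | no _ = inj₂ refl
  ... | no p | no q | yes r = ⊥-elim (ℕP.<-irrefl refl (ℕP.≤-<-trans (ℕP.≤-trans (ℕP.≮⇒≥ q) (ℕP.≮⇒≥ p)) r))
  ... | no _ | no _ | no _ = inj₁ refl

  orientation-consecutive : ∀ k → orientation (toℕ k) (toℕ (next k)) (toℕ (next (next k))) ≡ -[1+ 0 ]
  orientation-consecutive k with nextView k | nextView (next k)
  ... | inner _ q | inner _ r
    rewrite r | q
          | ltℤ-yes (ℕP.<-trans (ℕP.n<1+n (toℕ k)) (ℕP.n<1+n (suc (toℕ k))))
          | ltℤ-yes (ℕP.n<1+n (toℕ k)) | ltℤ-yes (ℕP.n<1+n (suc (toℕ k)))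
    = refl
  ... | inner _ q | seam _ r
    rewrite r | q
          | ltℤ-no {toℕ k} {0} (λ ()) | ltℤ-yes (ℕP.n<1+n (toℕ k)) | ltℤ-no {suc (toℕ k)} {0} (λ ())
    = refl
  ... | seam p q | inner _ r
    rewrite r | q | p
          | ltℤ-no {m} {1} (λ m<1 → m≢0 (ℕP.n<1⇒n≡0 m<1)) | ltℤ-no {m} {0} (λ ()) | ltℤ-yes {0} {1} (s≤s z≤n)
    = refl
  ... | seam _ q | seam p′ _ = ⊥-elim (m≢0 (trans (sym p′) q))

  potential-cocycle : ∀ s i j l →
    potential s i j + potential s j l - potential s i l ≡ orientation (toℕ (ρ s i)) (toℕ (ρ s j)) (toℕ (ρ s l))
  potential-cocycle s i j l =
    ring (W s i) (W s j) (W s l) (before (ρ s i) (ρ s j)) (before (ρ s j) (ρ s l)) (before (ρ s i) (ρ s l))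
    where
    ring : ∀ a b c x y z → (a - b - x) + (b - c - y) - (a - c - z) ≡ z - x - y
    ring = solve-∀

  -- Since the potential changes by exactly the signed crossings, the cocycle of the
  -- signed crossings of three elements is the change of their cyclic orientation.
  signedCrossings-cocycle : ∀ L s → Consistent s → ∀ {x y z} → x ≢ y → y ≢ z → x ≢ z →
    let es = events L (σ s) ; s′ = track L s in
    signedCrossings es x y + signedCrossings es y z - signedCrossings es x z
      ≡ orientation (toℕ (ρ s′ x)) (toℕ (ρ s′ y)) (toℕ (ρ s′ z))
        - orientation (toℕ (ρ s x)) (toℕ (ρ s y)) (toℕ (ρ s z))
  signedCrossings-cocycle L s c {x} {y} {z} x≢y y≢z x≢z
    rewrite sym (potential-cocycle (track L s) x y z) | sym (potential-cocycle s x y z)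
          | potential-track L s c x y x≢y | potential-track L s c y z y≢z | potential-track L s c x z x≢z
    = ring (potential s x y) (potential s y z) (potential s x z) _ _ _
    where
    ring : ∀ p q r A B C → A + B - C ≡ (p + A) + (q + B) - (r + C) - (p + q - r)
    ring = solve-∀

  crossCount-∷ : ∀ e (es : Events) i j → crossCount (e ∷ es) i j ≡ crossCount [ e ] i j ℕ.+ crossCount es i j
  crossCount-∷ (a , b) es i j with a ≟ i | b ≟ j | a ≟ j | b ≟ i
  ... | yes _ | yes _ | _ | _ = refl
  ... | no _ | _ | yes _ | yes _ = refl
  ... | yes _ | no _ | yes _ | yes _ = refl
  ... | no _ | _ | no _ | _ = refl
  ... | no _ | _ | yes _ | no _ = refl
  ... | yes _ | no _ | no _ | _ = refl
  ... | yes _ | no _ | yes _ | no _ = refl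

  signedCross≤crossCount : ∀ e i j → signedCross e i j ℤ.≤ + crossCount [ e ] i j
  signedCross≤crossCount (a , b) i j with a ≟ i | b ≟ j | a ≟ j | b ≟ i
  ... | yes _ | yes _ | _ | _ = ℤ.+≤+ ℕP.≤-refl
  ... | no _ | _ | yes _ | yes _ = ℤ.-≤+
  ... | yes _ | no _ | yes _ | yes _ = ℤ.-≤+
  ... | no _ | _ | no _ | _ = ℤ.+≤+ z≤n
  ... | no _ | _ | yes _ | no _ = ℤ.+≤+ z≤n
  ... | yes _ | no _ | no _ | _ = ℤ.+≤+ z≤n
  ... | yes _ | no _ | yes _ | no _ = ℤ.+≤+ z≤n

  signedCross-uncrossed : ∀ e i j → crossCount [ e ] i j ≡ 0 → signedCross e i j ≡ + 0
  signedCross-uncrossed (a , b) i j h with a ≟ i | b ≟ j | a ≟ j | b ≟ i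
  ... | yes _ | yes _ | _ | _ with () ← h
  ... | no _ | _ | yes _ | yes _ with () ← h
  ... | yes _ | no _ | yes _ | yes _ with () ← h
  ... | no _ | _ | no _ | _ = refl
  ... | no _ | _ | yes _ | no _ = refl
  ... | yes _ | no _ | no _ | _ = refl
  ... | yes _ | no _ | yes _ | no _ = refl

  signedCrossings≤crossCount : ∀ (es : Events) i j → signedCrossings es i j ℤ.≤ + crossCount es i j
  signedCrossings≤crossCount [] i j = ℤ.+≤+ z≤n
  signedCrossings≤crossCount (e ∷ es) i j rewrite crossCount-∷ e es i j =
    ℤP.+-mono-≤ (signedCross≤crossCount e i j) (signedCrossings≤crossCount es i j)

  signedCrossings-uncrossed : ∀ (es : Events) i j → crossCount es i j ≡ 0 → signedCrossings es i j ≡ + 0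
  signedCrossings-uncrossed [] i j h = refl
  signedCrossings-uncrossed (e ∷ es) i j h =
    cong₂ _+_ (signedCross-uncrossed e i j (ℕP.m+n≡0⇒m≡0 _ h′))
              (signedCrossings-uncrossed es i j (ℕP.m+n≡0⇒n≡0 (crossCount [ e ] i j) h′))
    where
    h′ : crossCount [ e ] i j ℕ.+ crossCount es i j ≡ 0
    h′ = trans (sym (crossCount-∷ e es i j)) h

  crossCount-tail : ∀ e (es : Events) i j → crossCount es i j ≤ crossCount (e ∷ es) i j
  crossCount-tail e es i j rewrite crossCount-∷ e es i j = ℕP.m≤n+m (crossCount es i j) (crossCount [ e ] i j)

  crossCount-head : ∀ (a b : Fin N) → crossCount [ (a , b) ] a b ≡ 1
  crossCount-head a b with a ≟ a | b ≟ b | a ≟ b | b ≟ a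
  ... | yes _ | yes _ | _ | _ = refl
  ... | no ≢ | _ | _ | _ = ⊥-elim (≢ refl)
  ... | yes _ | no ≢ | _ | _ = ⊥-elim (≢ refl)

  signedCrossings-head : ∀ a b (es : Events) → crossCount ((a , b) ∷ es) a b ≤ 1 →
                         signedCrossings ((a , b) ∷ es) a b ≡ + 1
  signedCrossings-head a b es h =
    cong₂ _+_ (signedCross-forward a b) (signedCrossings-uncrossed es a b rest-uncrossed)
    where
    rest-uncrossed : crossCount es a b ≡ 0
    rest-uncrossed = ℕP.n≤0⇒n≡0 (ℕP.≤-pred (subst (_≤ 1) (trans (crossCount-∷ (a , b) es a b) (cong (ℕ._+ crossCount es a b) (crossCount-head a b))) h))

  AtMostOnce : Ladder N → State N → Set
  AtMostOnce L σ = ∀ i j → i ≢ j → crossCount (events L σ) i j ≤ 1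

  atMostOnce-tail : ∀ k L σ → AtMostOnce (k ∷ L) σ → AtMostOnce L (swapAt k σ)
  atMostOnce-tail k L σ h i j i≢j = ℕP.≤-trans (crossCount-tail (σ k , σ (next k)) (events L (swapAt k σ)) i j) (h i j i≢j)

  -- By the cocycle identity the signed crossing number of x and z is 1 minus the final
  -- orientation, so it is 1 or 2, and 2 is excluded by AtMostOnce.
  crossing-transitive : ∀ L s → Consistent s → AtMostOnce L (σ s) → ∀ l →
    let es = events L (σ s) ; x = σ s l ; y = σ s (next l) ; z = σ s (next (next l)) in
    signedCrossings es x y ≡ + 1 → signedCrossings es y z ≡ + 1 → signedCrossings es x z ≡ + 1
  crossing-transitive L s c once l hxy hyz = conclude (orientation-values (toℕ (ρ s′ x)) (toℕ (ρ s′ y)) (toℕ (ρ s′ z)))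
    where
    es = events L (σ s)
    s′ = track L s
    x = σ s l
    y = σ s (next l)
    z = σ s (next (next l))
    x≢y : x ≢ y
    x≢y e = next≢self l (sym (TrackerStep.σ-injective {s} c e))
    y≢z : y ≢ z
    y≢z e = next≢self (next l) (sym (TrackerStep.σ-injective {s} c e))
    x≢z : x ≢ z
    x≢z e = next²≢self l (sym (TrackerStep.σ-injective {s} c e))
    o′ = orientation (toℕ (ρ s′ x)) (toℕ (ρ s′ y)) (toℕ (ρ s′ z))
    initially-consecutive : orientation (toℕ (ρ s x)) (toℕ (ρ s y)) (toℕ (ρ s z)) ≡ -[1+ 0 ]
    initially-consecutive rewrite proj₁ c l | proj₁ c (next l) | proj₁ c (next (next l)) = orientation-consecutive l
    cocycle : + 1 + + 1 - signedCrossings es x z ≡ o′ - -[1+ 0 ]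
    cocycle = begin
      + 1 + + 1 - signedCrossings es x z
        ≡⟨ cong₂ (λ p q → p + q - signedCrossings es x z) (sym hxy) (sym hyz) ⟩
      signedCrossings es x y + signedCrossings es y z - signedCrossings es x z
        ≡⟨ signedCrossings-cocycle L s c {x} {y} {z} x≢y y≢z x≢z ⟩
      o′ - orientation (toℕ (ρ s x)) (toℕ (ρ s y)) (toℕ (ρ s z))
        ≡⟨ cong (_-_ o′) initially-consecutive ⟩
      o′ - -[1+ 0 ] ∎
      where open ≡-Reasoning
    xz≡1-o : signedCrossings es x z ≡ + 1 - o′
    xz≡1-o = begin
      signedCrossings es x z                       ≡⟨ ring (signedCrossings es x z) ⟩
      + 1 - (+ 1 + + 1 - signedCrossings es x z + -[1+ 0 ]) ≡⟨ cong (λ t → + 1 - (t + -[1+ 0 ])) cocycle ⟩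
      + 1 - (o′ - -[1+ 0 ] + -[1+ 0 ])              ≡⟨ cong (_-_ (+ 1)) (ring′ o′) ⟩
      + 1 - o′ ∎
      where
      open ≡-Reasoning
      ring : ∀ C → C ≡ + 1 - (+ 1 + + 1 - C + -[1+ 0 ])
      ring = solve-∀
      ring′ : ∀ o → o - -[1+ 0 ] + -[1+ 0 ] ≡ o
      ring′ = solve-∀
    two≰crossCount : ¬ (+ 2 ℤ.≤ + crossCount es x z)
    two≰crossCount (ℤ.+≤+ 2≤cc) = ℕP.<⇒≱ (s≤s (once x z x≢z)) 2≤cc
    conclude : o′ ≡ + 0 ⊎ o′ ≡ -[1+ 0 ] → signedCrossings es x z ≡ + 1
    conclude (inj₁ o≡0) = trans xz≡1-o (cong (_-_ (+ 1)) o≡0)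
    conclude (inj₂ o≡-1) = ⊥-elim (two≰crossCount
      (subst (ℤ._≤ + crossCount es x z) (trans xz≡1-o (cong (_-_ (+ 1)) o≡-1)) (signedCrossings≤crossCount es x z)))

  dispE-∷ : ∀ e (es : Events) i → dispE (e ∷ es) i ≡ dispE [ e ] i + dispE es i
  dispE-∷ (a , b) es i with a ≟ i
  ... | yes _ = refl
  ... | no _ with b ≟ i
  ...   | yes _ = refl
  ...   | no _ = sym (ℤP.+-identityˡ _)

  crossSeqE-∷ : ∀ e (es : Events) i → crossSeqE (e ∷ es) i ≡ crossSeqE [ e ] i ++ crossSeqE es i
  crossSeqE-∷ (a , b) es i with a ≟ i
  ... | yes _ = refl
  ... | no _ with b ≟ i
  ...   | yes _ = refl
  ...   | no _ = refl

  crossSeqE-right : ∀ (a b : Fin N) → crossSeqE [ (a , b) ] a ≡ [ b ]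
  crossSeqE-right a b with a ≟ a
  ... | yes _ = refl
  ... | no ≢ = ⊥-elim (≢ refl)

  crossSeqE-left : ∀ (a b : Fin N) → a ≢ b → crossSeqE [ (a , b) ] b ≡ [ a ]
  crossSeqE-left a b a≢b with a ≟ b
  ... | yes e = ⊥-elim (a≢b e)
  ... | no _ with b ≟ b
  ...   | yes _ = refl
  ...   | no ≢ = ⊥-elim (≢ refl)

  crossSeqE-bystander : ∀ (a b i : Fin N) → a ≢ i → b ≢ i → crossSeqE [ (a , b) ] i ≡ []
  crossSeqE-bystander a b i a≢i b≢i with a ≟ i
  ... | yes e = ⊥-elim (a≢i e)
  ... | no _ with b ≟ i
  ...   | yes e = ⊥-elim (b≢i e)
  ...   | no _ = refl

  dispE-right : ∀ (a b : Fin N) → dispE [ (a , b) ] a ≡ + 1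
  dispE-right a b with a ≟ a
  ... | yes _ = refl
  ... | no ≢ = ⊥-elim (≢ refl)

  dispE-left : ∀ (a b : Fin N) → a ≢ b → dispE [ (a , b) ] b ≡ -[1+ 0 ]
  dispE-left a b a≢b with a ≟ b
  ... | yes e = ⊥-elim (a≢b e)
  ... | no _ with b ≟ b
  ...   | yes _ = refl
  ...   | no ≢ = ⊥-elim (≢ refl)

  dispE-bystander : ∀ (a b i : Fin N) → a ≢ i → b ≢ i → dispE [ (a , b) ] i ≡ + 0
  dispE-bystander a b i a≢i b≢i with a ≟ i
  ... | yes e = ⊥-elim (a≢i e)
  ... | no _ with b ≟ i
  ...   | yes e = ⊥-elim (b≢i e)
  ...   | no _ = refl

  signedCrossings-++ : ∀ (es r : Events) i j →
                       signedCrossings (es ++ r) i j ≡ signedCrossings es i j + signedCrossings r i j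
  signedCrossings-++ [] r i j = sym (ℤP.+-identityˡ _)
  signedCrossings-++ (e ∷ es) r i j =
    trans (cong (_+_ (signedCross e i j)) (signedCrossings-++ es r i j)) (sym (ℤP.+-assoc (signedCross e i j) _ _))

  crossCount-++ : ∀ (es r : Events) i j → crossCount (es ++ r) i j ≡ crossCount es i j ℕ.+ crossCount r i j
  crossCount-++ [] r i j = refl
  crossCount-++ (e ∷ es) r i j = begin
    crossCount (e ∷ es ++ r) i j                                       ≡⟨ crossCount-∷ e (es ++ r) i j ⟩
    crossCount [ e ] i j ℕ.+ crossCount (es ++ r) i j                   ≡⟨ cong (crossCount [ e ] i j ℕ.+_) (crossCount-++ es r i j) ⟩
    crossCount [ e ] i j ℕ.+ (crossCount es i j ℕ.+ crossCount r i j)   ≡⟨ ℕP.+-assoc (crossCount [ e ] i j) _ _ ⟨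
    crossCount [ e ] i j ℕ.+ crossCount es i j ℕ.+ crossCount r i j     ≡⟨ cong (ℕ._+ crossCount r i j) (crossCount-∷ e es i j) ⟨
    crossCount (e ∷ es) i j ℕ.+ crossCount r i j                       ∎
    where open ≡-Reasoning

  dispE-++ : ∀ (es r : Events) i → dispE (es ++ r) i ≡ dispE es i + dispE r i
  dispE-++ [] r i = sym (ℤP.+-identityˡ _)
  dispE-++ (e ∷ es) r i = begin
    dispE (e ∷ es ++ r) i                      ≡⟨ dispE-∷ e (es ++ r) i ⟩
    dispE [ e ] i + dispE (es ++ r) i           ≡⟨ cong (_+_ (dispE [ e ] i)) (dispE-++ es r i) ⟩
    dispE [ e ] i + (dispE es i + dispE r i)    ≡⟨ ℤP.+-assoc (dispE [ e ] i) _ _ ⟨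
    dispE [ e ] i + dispE es i + dispE r i      ≡⟨ cong (_+ dispE r i) (dispE-∷ e es i) ⟨
    dispE (e ∷ es) i + dispE r i               ∎
    where open ≡-Reasoning

  crossSeqE-++ : ∀ (es r : Events) i → crossSeqE (es ++ r) i ≡ crossSeqE es i ++ crossSeqE r i
  crossSeqE-++ [] r i = refl
  crossSeqE-++ (e ∷ es) r i = begin
    crossSeqE (e ∷ es ++ r) i                          ≡⟨ crossSeqE-∷ e (es ++ r) i ⟩
    crossSeqE [ e ] i ++ crossSeqE (es ++ r) i          ≡⟨ cong (crossSeqE [ e ] i ++_) (crossSeqE-++ es r i) ⟩
    crossSeqE [ e ] i ++ crossSeqE es i ++ crossSeqE r i ≡⟨ LP.++-assoc (crossSeqE [ e ] i) _ _ ⟨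
    (crossSeqE [ e ] i ++ crossSeqE es i) ++ crossSeqE r i ≡⟨ cong (_++ crossSeqE r i) (crossSeqE-∷ e es i) ⟨
    crossSeqE (e ∷ es) i ++ crossSeqE r i              ∎
    where open ≡-Reasoning

  record SameCounts (es es′ : Events) : Set where
    field
      signed       : ∀ i j → signedCrossings es i j ≡ signedCrossings es′ i j
      count        : ∀ i j → crossCount es i j ≡ crossCount es′ i j
      displacement : ∀ i → dispE es i ≡ dispE es′ i
  open SameCounts public

  sameCounts-≡ : ∀ {es es′} → es ≡ es′ → SameCounts es es′
  sameCounts-≡ refl = record { signed = λ _ _ → refl ; count = λ _ _ → refl ; displacement = λ _ → refl }

  sameCounts-sym : ∀ {es es′} → SameCounts es es′ → SameCounts es′ es
  sameCounts-sym h = record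
    { signed = λ i j → sym (signed h i j) ; count = λ i j → sym (count h i j) ; displacement = λ i → sym (displacement h i) }

  sameCounts-trans : ∀ {es es′ es″} → SameCounts es es′ → SameCounts es′ es″ → SameCounts es es″
  sameCounts-trans h g = record
    { signed = λ i j → trans (signed h i j) (signed g i j)
    ; count = λ i j → trans (count h i j) (count g i j)
    ; displacement = λ i → trans (displacement h i) (displacement g i) }

  sameCounts-++ : ∀ {es es′ r r′} → SameCounts es es′ → SameCounts r r′ → SameCounts (es ++ r) (es′ ++ r′)
  sameCounts-++ {es} {es′} {r} {r′} h g = record
    { signed = λ i j → trans (signedCrossings-++ es r i j)
                         (trans (cong₂ _+_ (signed h i j) (signed g i j)) (sym (signedCrossings-++ es′ r′ i j)))
    ; count = λ i j → trans (crossCount-++ es r i j)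
                        (trans (cong₂ ℕ._+_ (count h i j) (count g i j)) (sym (crossCount-++ es′ r′ i j)))
    ; displacement = λ i → trans (dispE-++ es r i)
                        (trans (cong₂ _+_ (displacement h i) (displacement g i)) (sym (dispE-++ es′ r′ i))) }

  sameCounts-swap : ∀ e f → SameCounts (e ∷ f ∷ []) (f ∷ e ∷ [])
  sameCounts-swap e f = record
    { signed = λ i j → ring (signedCross e i j) (signedCross f i j)
    ; count = λ i j → trans (crossCount-∷ e _ i j)
                        (trans (ℕP.+-comm (crossCount [ e ] i j) _) (sym (crossCount-∷ f _ i j)))
    ; displacement = λ i → trans (dispE-∷ e _ i) (trans (ℤP.+-comm (dispE [ e ] i) _) (sym (dispE-∷ f _ i))) }
    where
    ring : ∀ x y → x + (y + + 0) ≡ y + (x + + 0)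
    ring = solve-∀

  sameCounts-reverse₃ : ∀ e f g → SameCounts (e ∷ f ∷ g ∷ []) (g ∷ f ∷ e ∷ [])
  sameCounts-reverse₃ e f g =
    sameCounts-trans (sameCounts-++ (sameCounts-swap e f) (sameCounts-≡ refl))
      (sameCounts-trans (sameCounts-++ (sameCounts-≡ {[ f ]} refl) (sameCounts-swap e g))
        (sameCounts-++ (sameCounts-swap f g) (sameCounts-≡ refl)))

  crossSeqE-swap : ∀ (a b c d : Fin N) i → a ≢ c → a ≢ d → b ≢ c → b ≢ d →
                   crossSeqE ((a , b) ∷ (c , d) ∷ []) i ≡ crossSeqE ((c , d) ∷ (a , b) ∷ []) i
  crossSeqE-swap a b c d i a≢c a≢d b≢c b≢d =
    trans (crossSeqE-∷ (a , b) _ i)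
      (trans (swap-past-empty (one-is-empty (a ≟ i) (b ≟ i))) (sym (crossSeqE-∷ (c , d) _ i)))
    where
    swap-past-empty : ∀ {A B : List (Fin N)} → B ≡ [] ⊎ A ≡ [] → A ++ B ≡ B ++ A
    swap-past-empty {A} (inj₁ refl) = LP.++-identityʳ A
    swap-past-empty {B = B} (inj₂ refl) = sym (LP.++-identityʳ B)
    one-is-empty : Dec (a ≡ i) → Dec (b ≡ i) → crossSeqE [ (c , d) ] i ≡ [] ⊎ crossSeqE [ (a , b) ] i ≡ []
    one-is-empty (yes a≡i) _ =
      inj₁ (crossSeqE-bystander c d i (λ c≡i → a≢c (trans a≡i (sym c≡i))) (λ d≡i → a≢d (trans a≡i (sym d≡i))))
    one-is-empty (no _) (yes b≡i) =
      inj₁ (crossSeqE-bystander c d i (λ c≡i → b≢c (trans b≡i (sym c≡i))) (λ d≡i → b≢d (trans b≡i (sym d≡i))))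
    one-is-empty (no a≢i) (no b≢i) = inj₂ (crossSeqE-bystander a b i a≢i b≢i)

  Apart : Fin N → Fin N → Set
  Apart j k = j ≢ k × j ≢ next k × next j ≢ k

  apart-sym : ∀ {j k} → Apart j k → Apart k j
  apart-sym (j≢k , j≢nk , nj≢k) = ≢-sym j≢k , ≢-sym nj≢k , ≢-sym j≢nk

  next≢next : ∀ {j k} → j ≢ k → next j ≢ next k
  next≢next j≢k e = j≢k (next-injective e)

  events-apart : ∀ {j k} → Apart j k → ∀ σ →
                 events (j ∷ k ∷ []) σ ≡ (σ j , σ (next j)) ∷ (σ k , σ (next k)) ∷ []
  events-apart {j} {k} (j≢k , j≢nk , nj≢k) σ =
    cong₂ (λ x y → (σ j , σ (next j)) ∷ (x , y) ∷ [])
      (swapAt-other j σ (≢-sym j≢k) (≢-sym nj≢k))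
      (swapAt-other j σ (≢-sym j≢nk) (≢-sym (next≢next j≢k)))

  swapAt-commute : ∀ {j k} → Apart j k → ∀ σ → swapAt k (swapAt j σ) ≗ swapAt j (swapAt k σ)
  swapAt-commute {j} {k} (j≢k , j≢nk , nj≢k) σ l with lineCase j l | lineCase k l
  ... | at-bar refl  | at-bar e  = ⊥-elim (j≢k e)
  ... | at-bar refl  | at-next e = ⊥-elim (j≢nk e)
  ... | at-next refl | at-bar e  = ⊥-elim (nj≢k e)
  ... | at-next refl | at-next e = ⊥-elim (next≢next j≢k e)
  ... | at-bar refl  | off-bar p q = begin
    swapAt k (swapAt j σ) j  ≡⟨ swapAt-other k _ p q ⟩
    swapAt j σ j             ≡⟨ swapAt-here j σ ⟩
    σ (next j)               ≡⟨ sym (swapAt-other k σ nj≢k (next≢next j≢k)) ⟩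
    swapAt k σ (next j)      ≡⟨ sym (swapAt-here j _) ⟩
    swapAt j (swapAt k σ) j  ∎
    where open ≡-Reasoning
  ... | at-next refl | off-bar p q = begin
    swapAt k (swapAt j σ) (next j) ≡⟨ swapAt-other k _ p q ⟩
    swapAt j σ (next j)            ≡⟨ swapAt-next j σ ⟩
    σ j                            ≡⟨ sym (swapAt-other k σ j≢k j≢nk) ⟩
    swapAt k σ j                   ≡⟨ sym (swapAt-next j _) ⟩
    swapAt j (swapAt k σ) (next j) ∎
    where open ≡-Reasoning
  ... | off-bar p q  | at-bar refl = begin
    swapAt k (swapAt j σ) k  ≡⟨ swapAt-here k _ ⟩
    swapAt j σ (next k)      ≡⟨ swapAt-other j σ (≢-sym j≢nk) (≢-sym (next≢next j≢k)) ⟩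
    σ (next k)               ≡⟨ sym (swapAt-here k σ) ⟩
    swapAt k σ k             ≡⟨ sym (swapAt-other j _ p q) ⟩
    swapAt j (swapAt k σ) k  ∎
    where open ≡-Reasoning
  ... | off-bar p q  | at-next refl = begin
    swapAt k (swapAt j σ) (next k) ≡⟨ swapAt-next k _ ⟩
    swapAt j σ k                   ≡⟨ swapAt-other j σ (≢-sym j≢k) (≢-sym nj≢k) ⟩
    σ k                            ≡⟨ sym (swapAt-next k σ) ⟩
    swapAt k σ (next k)            ≡⟨ sym (swapAt-other j _ p q) ⟩
    swapAt j (swapAt k σ) (next k) ∎
    where open ≡-Reasoning
  ... | off-bar p q  | off-bar p′ q′ =
    trans (swapAt-other k _ p′ q′) (trans (swapAt-other j σ p q)
      (sym (trans (swapAt-other j _ p q) (swapAt-other k σ p′ q′))))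

  module BraidBars (k : Fin N) where

    private
      nk = next k
      nnk = next (next k)
      k≢nnk : k ≢ nnk
      k≢nnk e = next²≢self k (sym e)
      nnk≢k : nnk ≢ k
      nnk≢k = next²≢self k
      nnk≢nk : nnk ≢ nk
      nnk≢nk = next≢self nk

    events-braidₗ : ∀ σ → events (k ∷ nk ∷ k ∷ []) σ ≡ (σ k , σ nk) ∷ (σ k , σ nnk) ∷ (σ nk , σ nnk) ∷ []
    events-braidₗ σ = cong₂ (λ x y → (σ k , σ nk) ∷ x ∷ y ∷ [])
                       (cong₂ _,_ (swapAt-next k σ) (swapAt-other k σ nnk≢k nnk≢nk))
                       (cong₂ _,_ (trans (swapAt-other nk _ (self≢next k) k≢nnk) (swapAt-here k σ))
                                  (trans (swapAt-here nk _) (swapAt-other k σ nnk≢k nnk≢nk)))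

    events-braidᵣ : ∀ σ → events (nk ∷ k ∷ nk ∷ []) σ ≡ (σ nk , σ nnk) ∷ (σ k , σ nnk) ∷ (σ k , σ nk) ∷ []
    events-braidᵣ σ = cong₂ (λ x y → (σ nk , σ nnk) ∷ x ∷ y ∷ [])
                       (cong₂ _,_ (swapAt-other nk σ (self≢next k) k≢nnk) (swapAt-here nk σ))
                       (cong₂ _,_ (trans (swapAt-next k _) (swapAt-other nk σ (self≢next k) k≢nnk))
                                  (trans (swapAt-other k _ nnk≢k nnk≢nk) (swapAt-next nk σ)))

    swapAt-braid : ∀ σ → swapAt k (swapAt nk (swapAt k σ)) ≗ swapAt nk (swapAt k (swapAt nk σ))
    swapAt-braid σ l with lineCase k l | lineCase nk l
    ... | at-bar refl | _ = begin
      swapAt k (swapAt nk (swapAt k σ)) k   ≡⟨ swapAt-here k _ ⟩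
      swapAt nk (swapAt k σ) nk             ≡⟨ swapAt-here nk _ ⟩
      swapAt k σ nnk                        ≡⟨ swapAt-other k σ nnk≢k nnk≢nk ⟩
      σ nnk                                 ≡⟨ sym (swapAt-here nk σ) ⟩
      swapAt nk σ nk                        ≡⟨ sym (swapAt-here k _) ⟩
      swapAt k (swapAt nk σ) k              ≡⟨ sym (swapAt-other nk _ (self≢next k) k≢nnk) ⟩
      swapAt nk (swapAt k (swapAt nk σ)) k  ∎
      where open ≡-Reasoning
    ... | at-next refl | _ = begin
      swapAt k (swapAt nk (swapAt k σ)) nk  ≡⟨ swapAt-next k _ ⟩
      swapAt nk (swapAt k σ) k              ≡⟨ swapAt-other nk _ (self≢next k) k≢nnk ⟩
      swapAt k σ k                          ≡⟨ swapAt-here k σ ⟩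
      σ nk                                  ≡⟨ sym (swapAt-next nk σ) ⟩
      swapAt nk σ nnk                       ≡⟨ sym (swapAt-other k _ nnk≢k nnk≢nk) ⟩
      swapAt k (swapAt nk σ) nnk            ≡⟨ sym (swapAt-here nk _) ⟩
      swapAt nk (swapAt k (swapAt nk σ)) nk ∎
      where open ≡-Reasoning
    ... | off-bar _ q | at-bar e = ⊥-elim (q e)
    ... | off-bar _ _ | at-next refl = begin
      swapAt k (swapAt nk (swapAt k σ)) nnk  ≡⟨ swapAt-other k _ nnk≢k nnk≢nk ⟩
      swapAt nk (swapAt k σ) nnk             ≡⟨ swapAt-next nk _ ⟩
      swapAt k σ nk                          ≡⟨ swapAt-next k σ ⟩
      σ k                                    ≡⟨ sym (swapAt-other nk σ (self≢next k) k≢nnk) ⟩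
      swapAt nk σ k                          ≡⟨ sym (swapAt-next k _) ⟩
      swapAt k (swapAt nk σ) nk              ≡⟨ sym (swapAt-next nk _) ⟩
      swapAt nk (swapAt k (swapAt nk σ)) nnk ∎
      where open ≡-Reasoning
    ... | off-bar p q | off-bar _ r =
      trans (swapAt-other k _ p q) (trans (swapAt-other nk _ q r) (trans (swapAt-other k σ p q)
        (sym (trans (swapAt-other nk _ q r) (trans (swapAt-other k _ p q) (swapAt-other nk σ q r))))))

  record Preserves (L L′ : Ladder N) (σ : State N) : Set where
    field
      sameCounts : SameCounts (events L σ) (events L′ σ)
      sameRun    : run L σ ≗ run L′ σ
      sameLength : length L ≡ length L′
  open Preserves public

  preserves-refl : ∀ {L} σ → Preserves L L σ
  preserves-refl σ = record { sameCounts = sameCounts-≡ refl ; sameRun = λ _ → refl ; sameLength = refl }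

  preserves-sym : ∀ {L L′ σ} → Preserves L L′ σ → Preserves L′ L σ
  preserves-sym p = record
    { sameCounts = sameCounts-sym (sameCounts p) ; sameRun = λ l → sym (sameRun p l) ; sameLength = sym (sameLength p) }

  preserves-trans : ∀ {L L′ L″ σ} → Preserves L L′ σ → Preserves L′ L″ σ → Preserves L L″ σ
  preserves-trans p q = record
    { sameCounts = sameCounts-trans (sameCounts p) (sameCounts q)
    ; sameRun = λ l → trans (sameRun p l) (sameRun q l)
    ; sameLength = trans (sameLength p) (sameLength q) }

  preserves-in-context : ∀ xs ys {M M′} → (∀ σ → Preserves M M′ σ) → ∀ σ →
                         Preserves (xs ++ M ++ ys) (xs ++ M′ ++ ys) σ
  preserves-in-context xs ys {M} {M′} p σ = record
    { sameCounts = sameCounts-trans (sameCounts-≡ (split M))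
        (sameCounts-trans
          (sameCounts-++ (sameCounts-≡ {events xs σ} refl)
            (sameCounts-++ (sameCounts (p σ′)) (sameCounts-≡ (events-cong ys (sameRun (p σ′))))))
          (sameCounts-≡ (sym (split M′))))
    ; sameRun = λ l → begin
        run (xs ++ M ++ ys) σ l ≡⟨ cong (λ f → f l) (trans (run-++ xs _ σ) (run-++ M ys σ′)) ⟩
        run ys (run M σ′) l     ≡⟨ run-cong ys (sameRun (p σ′)) l ⟩
        run ys (run M′ σ′) l    ≡⟨ cong (λ f → f l) (sym (trans (run-++ xs _ σ) (run-++ M′ ys σ′))) ⟩
        run (xs ++ M′ ++ ys) σ l ∎
    ; sameLength = begin
        length (xs ++ M ++ ys)               ≡⟨ trans (LP.length-++ xs) (cong (length xs ℕ.+_) (LP.length-++ M)) ⟩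
        length xs ℕ.+ (length M ℕ.+ length ys)  ≡⟨ cong (λ n → length xs ℕ.+ (n ℕ.+ length ys)) (sameLength (p σ′)) ⟩
        length xs ℕ.+ (length M′ ℕ.+ length ys) ≡⟨ sym (trans (LP.length-++ xs) (cong (length xs ℕ.+_) (LP.length-++ M′))) ⟩
        length (xs ++ M′ ++ ys)              ∎ }
    where
    open ≡-Reasoning
    σ′ = run xs σ
    split : ∀ K → events (xs ++ K ++ ys) σ ≡ events xs σ ++ events K σ′ ++ events ys (run K σ′)
    split K = trans (events-++ xs _ σ) (cong (events xs σ ++_) (events-++ K ys σ′))

  preserves-apart : ∀ {j k} → Apart j k → ∀ σ → Preserves (j ∷ k ∷ []) (k ∷ j ∷ []) σ
  preserves-apart {j} {k} jk σ = record
    { sameCounts = sameCounts-trans (sameCounts-≡ (events-apart jk σ))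
        (sameCounts-trans (sameCounts-swap _ _) (sameCounts-≡ (sym (events-apart (apart-sym jk) σ))))
    ; sameRun = swapAt-commute jk σ
    ; sameLength = refl }

  preserves-braid : ∀ k σ → Preserves (k ∷ next k ∷ k ∷ []) (next k ∷ k ∷ next k ∷ []) σ
  preserves-braid k σ = record
    { sameCounts = sameCounts-trans (sameCounts-≡ (events-braidₗ σ))
        (sameCounts-trans (sameCounts-reverse₃ _ _ _) (sameCounts-≡ (sym (events-braidᵣ σ))))
    ; sameRun = swapAt-braid σ
    ; sameLength = refl }
    where open BraidBars k

  data Commute : Ladder N → Ladder N → Set where
    commute : ∀ (xs ys : Ladder N) {j k} → Apart j k → Commute (xs ++ j ∷ k ∷ ys) (xs ++ k ∷ j ∷ ys)

  Move : Ladder N → Ladder N → Set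
  Move L L′ = Commute L L′ ⊎ Braid L L′

  Reachable : Ladder N → Ladder N → Set
  Reachable = Star Move

  move-sym : ∀ {L L′} → Move L L′ → Move L′ L
  move-sym (inj₁ (commute xs ys jk)) = inj₁ (commute xs ys (apart-sym jk))
  move-sym (inj₂ (braidₗ xs ys k)) = inj₂ (braidᵣ xs ys k)
  move-sym (inj₂ (braidᵣ xs ys k)) = inj₂ (braidₗ xs ys k)

  reachable-sym : ∀ {L L′} → Reachable L L′ → Reachable L′ L
  reachable-sym = Star.reverse move-sym

  move-∷ : ∀ k {L L′} → Move L L′ → Move (k ∷ L) (k ∷ L′)
  move-∷ k (inj₁ (commute xs ys jk)) = inj₁ (commute (k ∷ xs) ys jk)
  move-∷ k (inj₂ (braidₗ xs ys l)) = inj₂ (braidₗ (k ∷ xs) ys l)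
  move-∷ k (inj₂ (braidᵣ xs ys l)) = inj₂ (braidᵣ (k ∷ xs) ys l)

  reachable-∷ : ∀ k {L L′} → Reachable L L′ → Reachable (k ∷ L) (k ∷ L′)
  reachable-∷ k = gmap (k ∷_) (move-∷ k)

  move-preserves : ∀ {L L′} σ → Move L L′ → Preserves L L′ σ
  move-preserves σ (inj₁ (commute xs ys jk)) = preserves-in-context xs ys (preserves-apart jk) σ
  move-preserves σ (inj₂ (braidₗ xs ys k)) = preserves-in-context xs ys (preserves-braid k) σ
  move-preserves σ (inj₂ (braidᵣ xs ys k)) = preserves-sym (preserves-in-context xs ys (preserves-braid k) σ)

  reachable-preserves : ∀ {L L′} σ → Reachable L L′ → Preserves L L′ σ
  reachable-preserves σ ε = preserves-refl σ
  reachable-preserves σ (mv ◅ r) = preserves-trans (move-preserves σ mv) (reachable-preserves σ r)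

  commute-crossSeqE : ∀ {L L′} σ → Injective _≡_ _≡_ σ → Commute L L′ →
                      ∀ i → crossSeqE (events L σ) i ≡ crossSeqE (events L′ σ) i
  commute-crossSeqE {L} {L′} σ inj (commute xs ys {j} {k} jk@(j≢k , j≢nk , nj≢k)) i = begin
    crossSeqE (events L σ) i
      ≡⟨ cong (λ es → crossSeqE es i) (split (j ∷ k ∷ [])) ⟩
    crossSeqE (events xs σ ++ events (j ∷ k ∷ []) σ′ ++ events ys (run (j ∷ k ∷ []) σ′)) i
      ≡⟨ trans (crossSeqE-++ (events xs σ) _ i) (cong (crossSeqE (events xs σ) i ++_) (crossSeqE-++ (events (j ∷ k ∷ []) σ′) _ i)) ⟩
    crossSeqE (events xs σ) i ++ crossSeqE (events (j ∷ k ∷ []) σ′) i ++ crossSeqE (events ys (run (j ∷ k ∷ []) σ′)) i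
      ≡⟨ cong₂ (λ A B → crossSeqE (events xs σ) i ++ A ++ B) middle
               (cong (λ es → crossSeqE es i) (events-cong ys (swapAt-commute jk σ′))) ⟩
    crossSeqE (events xs σ) i ++ crossSeqE (events (k ∷ j ∷ []) σ′) i ++ crossSeqE (events ys (run (k ∷ j ∷ []) σ′)) i
      ≡⟨ sym (trans (crossSeqE-++ (events xs σ) _ i) (cong (crossSeqE (events xs σ) i ++_) (crossSeqE-++ (events (k ∷ j ∷ []) σ′) _ i))) ⟩
    crossSeqE (events xs σ ++ events (k ∷ j ∷ []) σ′ ++ events ys (run (k ∷ j ∷ []) σ′)) i
      ≡⟨ cong (λ es → crossSeqE es i) (sym (split (k ∷ j ∷ []))) ⟩
    crossSeqE (events L′ σ) i ∎
    where
    open ≡-Reasoning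
    σ′ = run xs σ
    inj′ = run-injective xs inj
    split : ∀ K → events (xs ++ K ++ ys) σ ≡ events xs σ ++ events K σ′ ++ events ys (run K σ′)
    split K = trans (events-++ xs _ σ) (cong (events xs σ ++_) (events-++ K ys σ′))
    middle : crossSeqE (events (j ∷ k ∷ []) σ′) i ≡ crossSeqE (events (k ∷ j ∷ []) σ′) i
    middle = begin
      crossSeqE (events (j ∷ k ∷ []) σ′) i
        ≡⟨ cong (λ es → crossSeqE es i) (events-apart jk σ′) ⟩
      crossSeqE ((σ′ j , σ′ (next j)) ∷ (σ′ k , σ′ (next k)) ∷ []) i
        ≡⟨ crossSeqE-swap _ _ _ _ i (λ e → j≢k (inj′ e)) (λ e → j≢nk (inj′ e))
                                    (λ e → nj≢k (inj′ e)) (λ e → next≢next j≢k (inj′ e)) ⟩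
      crossSeqE ((σ′ k , σ′ (next k)) ∷ (σ′ j , σ′ (next j)) ∷ []) i
        ≡⟨ cong (λ es → crossSeqE es i) (sym (events-apart (apart-sym jk) σ′)) ⟩
      crossSeqE (events (k ∷ j ∷ []) σ′) i ∎

  signedCrossings-drop : ∀ e (es : Events) x y → signedCross e x y ≡ + 0 →
                         signedCrossings (e ∷ es) x y ≡ + 1 → signedCrossings es x y ≡ + 1
  signedCrossings-drop e es x y e-uncrossed h =
    trans (sym (trans (cong (_+ signedCrossings es x y) e-uncrossed) (ℤP.+-identityˡ _))) h

  atMostOnce-reachable : ∀ {L L′} σ → Reachable L L′ → AtMostOnce L σ → AtMostOnce L′ σ
  atMostOnce-reachable σ r h i j i≢j = subst (_≤ 1) (count (sameCounts (reachable-preserves σ r)) i j) (h i j i≢j)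

  crosses-at-head : ∀ j M {σ : State N} → Injective _≡_ _≡_ σ → AtMostOnce (j ∷ M) σ →
                    signedCrossings (events (j ∷ M) σ) (σ j) (σ (next j)) ≡ + 1
  crosses-at-head j M {σ} inj once = signedCrossings-head (σ j) (σ (next j)) _ (once _ _ (λ e → self≢next j (inj e)))

  BringsToFront : ℕ → Set
  BringsToFront f = ∀ L s → Consistent s → length L ≤ f → AtMostOnce L (σ s) → ∀ k →
                    signedCrossings (events L (σ s)) (σ s k) (σ s (next k)) ≡ + 1 →
                    ∃ λ L′ → Reachable L (k ∷ L′)

  module BringToFront (f : ℕ) (rec : BringsToFront f) (M : Ladder N) (s : Tracker) (c : Consistent s)
                      (M≤f : length M ≤ f) where
    private
      σ₀ = σ s
      inj = TrackerStep.σ-injective {s} c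

      shorter : ∀ {σ₁ k L₁} → Reachable M (k ∷ L₁) → length L₁ ≤ f
      shorter {σ₁} r = ℕP.≤-trans (ℕP.n≤1+n _) (subst (_≤ f) (sameLength (reachable-preserves σ₁ r)) M≤f)

      still-once : ∀ j {k L₁} → AtMostOnce (j ∷ M) σ₀ → Reachable M (k ∷ L₁) →
                   AtMostOnce L₁ (swapAt k (swapAt j σ₀))
      still-once j {k} {L₁} once r =
        atMostOnce-tail k L₁ (swapAt j σ₀) (atMostOnce-reachable (swapAt j σ₀) r (atMostOnce-tail j M σ₀ once))

    front-apart : ∀ j k → Apart j k → AtMostOnce (j ∷ M) σ₀ →
                  signedCrossings (events (j ∷ M) σ₀) (σ₀ k) (σ₀ (next k)) ≡ + 1 → ∃ λ L′ → Reachable (j ∷ M) (k ∷ L′)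
    front-apart j k jk@(j≢k , j≢nk , nj≢k) once h =
      j ∷ proj₁ IH , (reachable-∷ j (proj₂ IH) ◅◅ inj₁ (commute [] (proj₁ IH) jk) ◅ ε)
      where
      σ₁ = swapAt j σ₀
      σ₁k : σ₁ k ≡ σ₀ k
      σ₁k = swapAt-other j σ₀ (≢-sym j≢k) (≢-sym nj≢k)
      σ₁nk : σ₁ (next k) ≡ σ₀ (next k)
      σ₁nk = swapAt-other j σ₀ (≢-sym j≢nk) (≢-sym (next≢next j≢k))
      in-M : signedCrossings (events M σ₁) (σ₁ k) (σ₁ (next k)) ≡ + 1
      in-M = subst₂ (λ x y → signedCrossings (events M σ₁) x y ≡ + 1) (sym σ₁k) (sym σ₁nk)
               (signedCrossings-drop _ (events M σ₁) (σ₀ k) (σ₀ (next k))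
                 (signedCross-unrelated (σ₀ j) (σ₀ (next j)) (σ₀ k) (σ₀ (next k))
                   (λ (e , _) → j≢k (inj e)) (λ (e , _) → j≢nk (inj e))) h)
      IH = rec M (step j s) (TrackerStep.consistent-step {s} c j) M≤f (atMostOnce-tail j M σ₀ once) k in-M

    -- The bar at next k makes b cross e, so a crosses e as well; both crossings can be
    -- brought forward, after which k, next k, k is turned into next k, k, next k.
    front-after : ∀ k → AtMostOnce (next k ∷ M) σ₀ →
                  signedCrossings (events (next k ∷ M) σ₀) (σ₀ k) (σ₀ (next k)) ≡ + 1 →
                  ∃ λ L′ → Reachable (next k ∷ M) (k ∷ L′)
    front-after k once ab =
      next k ∷ k ∷ L₂ , (reachable-∷ (next k) (r₁ ◅◅ reachable-∷ k r₂) ◅◅ inj₂ (braidᵣ [] L₂ k) ◅ ε)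
      where
      a = σ₀ k
      b = σ₀ (next k)
      e = σ₀ (next (next k))
      a≢b : a ≢ b
      a≢b q = self≢next k (inj q)
      b≢e : b ≢ e
      b≢e q = self≢next (next k) (inj q)
      a≢e : a ≢ e
      a≢e q = next²≢self k (sym (inj q))
      ae : signedCrossings (events (next k ∷ M) σ₀) a e ≡ + 1
      ae = crossing-transitive (next k ∷ M) s c once k ab (crosses-at-head (next k) M inj once)
      s₁ = step (next k) s
      σ₁ = σ s₁
      σ₁k : σ₁ k ≡ a
      σ₁k = swapAt-other (next k) σ₀ (self≢next k) (λ q → next²≢self k (sym q))
      σ₁nk : σ₁ (next k) ≡ e
      σ₁nk = swapAt-here (next k) σ₀
      ae-in-M : signedCrossings (events M σ₁) (σ₁ k) (σ₁ (next k)) ≡ + 1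
      ae-in-M = subst₂ (λ x y → signedCrossings (events M σ₁) x y ≡ + 1) (sym σ₁k) (sym σ₁nk)
                  (signedCrossings-drop _ (events M σ₁) a e
                    (signedCross-unrelated b e a e (λ (q , _) → a≢b (sym q)) (λ (q , _) → b≢e q)) ae)
      R₁ = rec M s₁ (TrackerStep.consistent-step {s} c (next k)) M≤f (atMostOnce-tail (next k) M σ₀ once) k ae-in-M
      L₁ = proj₁ R₁
      r₁ = proj₂ R₁
      s₂ = step k s₁
      σ₂ = σ s₂
      σ₂nk : σ₂ (next k) ≡ a
      σ₂nk = trans (swapAt-next k σ₁) σ₁k
      σ₂nnk : σ₂ (next (next k)) ≡ b
      σ₂nnk = trans (swapAt-other k σ₁ (next²≢self k) (λ q → self≢next (next k) (sym q))) (swapAt-next (next k) σ₀)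
      ab-in-kL₁ : signedCrossings (events (k ∷ L₁) σ₁) a b ≡ + 1
      ab-in-kL₁ = trans (sym (signed (sameCounts (reachable-preserves σ₁ r₁)) a b))
                    (signedCrossings-drop _ (events M σ₁) a b
                      (signedCross-unrelated b e a b (λ (q , _) → a≢b (sym q)) (λ (_ , q) → a≢e (sym q))) ab)
      ab-in-L₁ : signedCrossings (events L₁ σ₂) (σ₂ (next k)) (σ₂ (next (next k))) ≡ + 1
      ab-in-L₁ = subst₂ (λ x y → signedCrossings (events L₁ σ₂) x y ≡ + 1) (sym σ₂nk) (sym σ₂nnk)
                   (signedCrossings-drop (σ₁ k , σ₁ (next k)) (events L₁ σ₂) a b
                     (subst₂ (λ x y → signedCross (x , y) a b ≡ + 0) (sym σ₁k) (sym σ₁nk)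
                       (signedCross-unrelated a e a b (λ (_ , q) → b≢e (sym q)) (λ (q , _) → a≢b q))) ab-in-kL₁)
      R₂ = rec L₁ s₂ (TrackerStep.consistent-step {s₁} (TrackerStep.consistent-step {s} c (next k)) k)
               (shorter {σ₁} r₁) (still-once (next k) once r₁) (next k) ab-in-L₁
      L₂ = proj₁ R₂
      r₂ = proj₂ R₂

    -- Symmetric to front-after: the bar at j makes z cross a, hence z crosses b.
    front-before : ∀ j → AtMostOnce (j ∷ M) σ₀ →
                   signedCrossings (events (j ∷ M) σ₀) (σ₀ (next j)) (σ₀ (next (next j))) ≡ + 1 →
                   ∃ λ L′ → Reachable (j ∷ M) (next j ∷ L′)
    front-before j once ab =
      j ∷ next j ∷ L₂ , (reachable-∷ j (r₁ ◅◅ reachable-∷ (next j) r₂) ◅◅ inj₂ (braidₗ [] L₂ j) ◅ ε)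
      where
      z = σ₀ j
      a = σ₀ (next j)
      b = σ₀ (next (next j))
      z≢a : z ≢ a
      z≢a q = self≢next j (inj q)
      a≢b : a ≢ b
      a≢b q = self≢next (next j) (inj q)
      z≢b : z ≢ b
      z≢b q = next²≢self j (sym (inj q))
      zb : signedCrossings (events (j ∷ M) σ₀) z b ≡ + 1
      zb = crossing-transitive (j ∷ M) s c once j (crosses-at-head j M inj once) ab
      s₁ = step j s
      σ₁ = σ s₁
      σ₁nj : σ₁ (next j) ≡ z
      σ₁nj = swapAt-next j σ₀
      σ₁nnj : σ₁ (next (next j)) ≡ b
      σ₁nnj = swapAt-other j σ₀ (next²≢self j) (λ q → self≢next (next j) (sym q))
      zb-in-M : signedCrossings (events M σ₁) (σ₁ (next j)) (σ₁ (next (next j))) ≡ + 1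
      zb-in-M = subst₂ (λ x y → signedCrossings (events M σ₁) x y ≡ + 1) (sym σ₁nj) (sym σ₁nnj)
                  (signedCrossings-drop _ (events M σ₁) z b
                    (signedCross-unrelated z a z b (λ (_ , q) → a≢b q) (λ (q , _) → z≢b q)) zb)
      R₁ = rec M s₁ (TrackerStep.consistent-step {s} c j) M≤f (atMostOnce-tail j M σ₀ once) (next j) zb-in-M
      L₁ = proj₁ R₁
      r₁ = proj₂ R₁
      s₂ = step (next j) s₁
      σ₂ = σ s₂
      σ₂j : σ₂ j ≡ a
      σ₂j = trans (swapAt-other (next j) σ₁ (self≢next j) (λ q → next²≢self j (sym q))) (swapAt-here j σ₀)
      σ₂nj : σ₂ (next j) ≡ b
      σ₂nj = trans (swapAt-here (next j) σ₁) σ₁nnj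
      ab-in-njL₁ : signedCrossings (events (next j ∷ L₁) σ₁) a b ≡ + 1
      ab-in-njL₁ = trans (sym (signed (sameCounts (reachable-preserves σ₁ r₁)) a b))
                     (signedCrossings-drop _ (events M σ₁) a b
                       (signedCross-unrelated z a a b (λ (q , _) → z≢a q) (λ (q , _) → z≢b q)) ab)
      ab-in-L₁ : signedCrossings (events L₁ σ₂) (σ₂ j) (σ₂ (next j)) ≡ + 1
      ab-in-L₁ = subst₂ (λ x y → signedCrossings (events L₁ σ₂) x y ≡ + 1) (sym σ₂j) (sym σ₂nj)
                   (signedCrossings-drop (σ₁ (next j) , σ₁ (next (next j))) (events L₁ σ₂) a b
                     (subst₂ (λ x y → signedCross (x , y) a b ≡ + 0) (sym σ₁nj) (sym σ₁nnj)
                       (signedCross-unrelated z b a b (λ (q , _) → z≢a q) (λ (q , _) → z≢b q))) ab-in-njL₁)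
      R₂ = rec L₁ s₂ (TrackerStep.consistent-step {s₁} (TrackerStep.consistent-step {s} c j) (next j))
               (shorter {σ₁} r₁) (still-once j once r₁) j ab-in-L₁
      L₂ = proj₁ R₂
      r₂ = proj₂ R₂

  bringToFront : ∀ f → BringsToFront f
  bringToFront f [] s c _ _ k ()
  bringToFront zero (j ∷ M) s c () once k h
  bringToFront (suc f) (j ∷ M) s c (s≤s M≤f) once k h with j ≟ k
  ... | yes refl = M , ε
  ... | no j≢k with j ≟ next k
  ...   | yes refl = BringToFront.front-after f (bringToFront f) M s c M≤f k once h
  ...   | no j≢nk with next j ≟ k
  ...     | yes refl = BringToFront.front-before f (bringToFront f) M s c M≤f j once h
  ...     | no nj≢k = BringToFront.front-apart f (bringToFront f) M s c M≤f j k (j≢k , j≢nk , nj≢k) once h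

  reachable-of-signedCrossings : ∀ f (L L′ : Ladder N) s → Consistent s → length L ≤ f →
    AtMostOnce L (σ s) → AtMostOnce L′ (σ s) →
    (∀ i j → i ≢ j → signedCrossings (events L (σ s)) i j ≡ signedCrossings (events L′ (σ s)) i j) →
    Reachable L L′
  reachable-of-signedCrossings f [] [] s c _ _ _ _ = ε
  reachable-of-signedCrossings f [] (j ∷ M′) s c _ _ once′ same
    with () ← trans (same _ _ (λ e → self≢next j (TrackerStep.σ-injective {s} c e))) (crosses-at-head j M′ (TrackerStep.σ-injective {s} c) once′)
  reachable-of-signedCrossings zero (k ∷ M) L′ s c () once once′ same
  reachable-of-signedCrossings (suc f) (k ∷ M) L′ s c (s≤s M≤f) once once′ same =
    reachable-∷ k IH ◅◅ reachable-sym r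
    where
    σ₀ = σ s
    a≢b = λ e → self≢next k (TrackerStep.σ-injective {s} c e)
    in-L′ : signedCrossings (events L′ σ₀) (σ₀ k) (σ₀ (next k)) ≡ + 1
    in-L′ = trans (sym (same _ _ a≢b)) (crosses-at-head k M (TrackerStep.σ-injective {s} c) once)
    R = bringToFront (length L′) L′ s c ℕP.≤-refl once′ k in-L′
    r = proj₂ R
    same-tail : ∀ i j → i ≢ j →
      signedCrossings (events M (swapAt k σ₀)) i j ≡ signedCrossings (events (proj₁ R) (swapAt k σ₀)) i j
    same-tail i j i≢j = ∙-cancelˡ (signedCross (σ₀ k , σ₀ (next k)) i j) _ _
                          (trans (same i j i≢j) (signed (sameCounts (reachable-preserves σ₀ r)) i j))
    IH = reachable-of-signedCrossings f M (proj₁ R) (step k s) (TrackerStep.consistent-step {s} c k) M≤f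
           (atMostOnce-tail k M σ₀ once) (atMostOnce-tail k (proj₁ R) σ₀ (atMostOnce-reachable σ₀ r once′)) same-tail

  crossSeqE-head-right : ∀ j R (σ : State N) →
    crossSeqE (events (j ∷ R) σ) (σ j) ≡ σ (next j) ∷ crossSeqE (events R (swapAt j σ)) (σ j)
  crossSeqE-head-right j R σ =
    trans (crossSeqE-∷ (σ j , σ (next j)) (events R (swapAt j σ)) (σ j))
      (cong (_++ crossSeqE (events R (swapAt j σ)) (σ j)) (crossSeqE-right (σ j) (σ (next j))))

  crossSeqE-head-left : ∀ j R (σ : State N) → σ j ≢ σ (next j) →
    crossSeqE (events (j ∷ R) σ) (σ (next j)) ≡ σ j ∷ crossSeqE (events R (swapAt j σ)) (σ (next j))
  crossSeqE-head-left j R σ ≢ =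
    trans (crossSeqE-∷ (σ j , σ (next j)) (events R (swapAt j σ)) (σ (next j)))
      (cong (_++ crossSeqE (events R (swapAt j σ)) (σ (next j))) (crossSeqE-left (σ j) (σ (next j)) ≢))

  Commutes : Ladder N → Ladder N → Set
  Commutes = Star Commute

  commutes-crossSeqE : ∀ {L L′} σ → Injective _≡_ _≡_ σ → Commutes L L′ →
                       ∀ i → crossSeqE (events L σ) i ≡ crossSeqE (events L′ σ) i
  commutes-crossSeqE σ inj ε i = refl
  commutes-crossSeqE σ inj (c ◅ r) i = trans (commute-crossSeqE σ inj c i) (commutes-crossSeqE σ inj r i)

  commutes-dispE : ∀ {L L′} σ → Commutes L L′ → ∀ i → dispE (events L σ) i ≡ dispE (events L′ σ) i
  commutes-dispE σ r = displacement (sameCounts (reachable-preserves σ (Star.map inj₁ r)))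

  pull-to-front : ∀ k P R → All (λ p → Apart p k) P → Commutes (P ++ k ∷ R) (k ∷ P ++ R)
  pull-to-front k [] R [] = ε
  pull-to-front k (p ∷ P) R (pk ∷ Pk) =
    gmap (p ∷_) (λ { (commute xs ys jk) → commute (p ∷ xs) ys jk }) (pull-to-front k P R Pk)
      ◅◅ commute [] (P ++ R) pk ◅ ε

  first-crossing-bar : ∀ (L : Ladder N) σ → Injective _≡_ _≡_ σ → ∀ k {u w} →
    crossSeqE (events L σ) (σ k) ≡ σ (next k) ∷ u →
    crossSeqE (events L σ) (σ (next k)) ≡ σ k ∷ w →
    ∃ λ P → ∃ λ R → L ≡ P ++ k ∷ R × All (λ p → Apart p k) P
  first-crossing-bar [] σ inj k () _
  first-crossing-bar (j ∷ R) σ inj k hk hnk with j ≟ k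
  ... | yes refl = [] , R , refl , []
  ... | no j≢k with j ≟ next k
  ...   | yes refl =
    ⊥-elim (next²≢self k (inj (LP.∷-injectiveˡ (trans (sym (crossSeqE-head-right (next k) R σ)) hnk))))
  ...   | no j≢nk with next j ≟ k
  ...     | yes refl =
    ⊥-elim (j≢nk (inj (LP.∷-injectiveˡ (trans (sym (crossSeqE-head-left j R σ (λ e → self≢next j (inj e)))) hk))))
  ...     | no nj≢k = let (P , R′ , R≡ , Pk) = IH in j ∷ P , R′ , cong (j ∷_) R≡ , (j≢k , j≢nk , nj≢k) ∷ Pk
    where
    σ₁ = swapAt j σ
    σ₁k : σ₁ k ≡ σ k
    σ₁k = swapAt-other j σ (≢-sym j≢k) (≢-sym nj≢k)
    σ₁nk : σ₁ (next k) ≡ σ (next k)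
    σ₁nk = swapAt-other j σ (≢-sym j≢nk) (≢-sym (next≢next j≢k))
    uninvolved : ∀ x → x ≡ σ k ⊎ x ≡ σ (next k) → crossSeqE (events (j ∷ R) σ) x ≡ crossSeqE (events R σ₁) x
    uninvolved x x∈ = trans (crossSeqE-∷ (σ j , σ (next j)) (events R σ₁) x)
      (cong (_++ crossSeqE (events R σ₁) x) (crossSeqE-bystander (σ j) (σ (next j)) x (σj≢ x∈) (σnj≢ x∈)))
      where
      σj≢ : x ≡ σ k ⊎ x ≡ σ (next k) → σ j ≢ x
      σj≢ (inj₁ refl) e = j≢k (inj e)
      σj≢ (inj₂ refl) e = j≢nk (inj e)
      σnj≢ : x ≡ σ k ⊎ x ≡ σ (next k) → σ (next j) ≢ x
      σnj≢ (inj₁ refl) e = nj≢k (inj e)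
      σnj≢ (inj₂ refl) e = next≢next j≢k (inj e)
    IH = first-crossing-bar R σ₁ (swapAt-injective j inj) k
           (subst₂ (λ x y → crossSeqE (events R σ₁) x ≡ y ∷ _) (sym σ₁k) (sym σ₁nk) (trans (sym (uninvolved _ (inj₁ refl))) hk))
           (subst₂ (λ x y → crossSeqE (events R σ₁) x ≡ y ∷ _) (sym σ₁nk) (sym σ₁k) (trans (sym (uninvolved _ (inj₂ refl))) hnk))

  -- Peel off the first bar of L; the same bar can be commuted to the front of L′.
  dispE-of-crossSeqE : ∀ f (L L′ : Ladder N) σ → Injective _≡_ _≡_ σ → length L ≤ f →
    (∀ i → crossSeqE (events L σ) i ≡ crossSeqE (events L′ σ) i) →
    ∀ i → dispE (events L σ) i ≡ dispE (events L′ σ) i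
  dispE-of-crossSeqE f [] [] σ inj _ same i = refl
  dispE-of-crossSeqE f [] (j ∷ M′) σ inj _ same i with () ← trans (same (σ j)) (crossSeqE-head-right j M′ σ)
  dispE-of-crossSeqE zero (k ∷ M) L′ σ inj () same i
  dispE-of-crossSeqE (suc f) (k ∷ M) L′ σ inj (s≤s M≤f) same i = begin
    dispE (events (k ∷ M) σ) i          ≡⟨ dispE-∷ e (events M σ₁) i ⟩
    dispE [ e ] i + dispE (events M σ₁) i ≡⟨ cong (_+_ (dispE [ e ] i)) IH ⟩
    dispE [ e ] i + dispE (events (P ++ R) σ₁) i ≡⟨ sym (dispE-∷ e (events (P ++ R) σ₁) i) ⟩
    dispE (events (k ∷ P ++ R) σ) i      ≡⟨ sym (commutes-dispE σ pulled i) ⟩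
    dispE (events L′ σ) i ∎
    where
    open ≡-Reasoning
    e = (σ k , σ (next k))
    σ₁ = swapAt k σ
    σk≢σnk : σ k ≢ σ (next k)
    σk≢σnk q = self≢next k (inj q)
    found = first-crossing-bar L′ σ inj k (trans (sym (same (σ k))) (crossSeqE-head-right k M σ))
                                          (trans (sym (same (σ (next k)))) (crossSeqE-head-left k M σ σk≢σnk))
    P = proj₁ found
    R = proj₁ (proj₂ found)
    pulled : Commutes L′ (k ∷ P ++ R)
    pulled = subst (λ L → Commutes L (k ∷ P ++ R)) (sym (proj₁ (proj₂ (proj₂ found))))
                   (pull-to-front k P R (proj₂ (proj₂ (proj₂ found))))
    same-tail : ∀ x → crossSeqE (events M σ₁) x ≡ crossSeqE (events (P ++ R) σ₁) x
    same-tail x = LP.++-cancelˡ (crossSeqE [ e ] x) _ _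
      (trans (sym (crossSeqE-∷ e (events M σ₁) x))
        (trans (same x) (trans (commutes-crossSeqE σ inj pulled x) (crossSeqE-∷ e (events (P ++ R) σ₁) x))))
    IH = dispE-of-crossSeqE f M (P ++ R) σ₁ (swapAt-injective k inj) M≤f same-tail i

  -- The position of an element on the universal cover of the cylinder.
  lift : Tracker → Fin N → ℤ
  lift s i = + toℕ (ρ s i) + + N * W s i

  dispE-step : ∀ {s} → Consistent s → ∀ k i →
               dispE [ (σ s k , σ s (next k)) ] i ≡ lift (step k s) i - lift s i
  dispE-step {s} c k i with TrackerStep.elementCase {s} c k i | nextView k
  ... | TrackerStep.left-end refl | inner p q
    rewrite TrackerStep.ρ-left {s} c k | TrackerStep.W-left {s} c k | proj₁ c k | dispE-right (σ s k) (σ s (next k)) | isSeam-inner k p | q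
    = ring (+ N) (+ toℕ k) (W s (σ s k))
    where
    ring : ∀ n x w → + 1 ≡ (+ 1 + x + n * (w + + 0)) - (x + n * w)
    ring = solve-∀
  ... | TrackerStep.left-end refl | seam p q
    rewrite TrackerStep.ρ-left {s} c k | TrackerStep.W-left {s} c k | proj₁ c k | dispE-right (σ s k) (σ s (next k)) | isSeam-seam k p | q | p
    = ring (+ m) (W s (σ s k))
    where
    ring : ∀ x w → + 1 ≡ (+ 0 + (+ 1 + x) * (w + + 1)) - (x + (+ 1 + x) * w)
    ring = solve-∀
  ... | TrackerStep.right-end refl | inner p q
    rewrite TrackerStep.ρ-right {s} c k | TrackerStep.W-right {s} c k | proj₁ c (next k) | isSeam-inner k p | q
          | dispE-left (σ s k) (σ s (next k)) (λ e → TrackerStep.σ-next≢σ {s} c k (sym e))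
    = ring (+ N) (+ toℕ k) (W s (σ s (next k)))
    where
    ring : ∀ n x w → -[1+ 0 ] ≡ (x + n * (w - + 0)) - (+ 1 + x + n * w)
    ring = solve-∀
  ... | TrackerStep.right-end refl | seam p q
    rewrite TrackerStep.ρ-right {s} c k | TrackerStep.W-right {s} c k | proj₁ c (next k) | isSeam-seam k p | q
          | dispE-left (σ s k) (σ s (next k)) (λ e → TrackerStep.σ-next≢σ {s} c k (sym e))
    = subst (λ n → -[1+ 0 ] ≡ (+ toℕ k + n * (W s (σ s (next k)) - + 1)) - (+ 0 + n * W s (σ s (next k))))
            (cong (λ x → + suc x) p) (ring (+ toℕ k) (W s (σ s (next k))))
    where
    ring : ∀ x w → -[1+ 0 ] ≡ (x + (+ 1 + x) * (w - + 1)) - (+ 0 + (+ 1 + x) * w)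
    ring = solve-∀
  ... | TrackerStep.elsewhere p₁ p₂ _ _ | _
    rewrite TrackerStep.ρ-other {s} c k p₁ p₂ | TrackerStep.W-other {s} c k p₁ p₂
          | dispE-bystander (σ s k) (σ s (next k)) i (λ e → p₁ (sym e)) (λ e → p₂ (sym e))
    = sym (ℤP.+-inverseʳ (lift s i))

  dispE-track : ∀ L s → Consistent s → ∀ i → dispE (events L (σ s)) i ≡ lift (track L s) i - lift s i
  dispE-track [] s c i = sym (ℤP.+-inverseʳ (lift s i))
  dispE-track (k ∷ L) s c i = begin
    dispE (events (k ∷ L) (σ s)) i
      ≡⟨ dispE-∷ (σ s k , σ s (next k)) (events L (swapAt k (σ s))) i ⟩
    dispE [ (σ s k , σ s (next k)) ] i + dispE (events L (σ (step k s))) i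
      ≡⟨ cong₂ _+_ (dispE-step c k i) (dispE-track L (step k s) (TrackerStep.consistent-step {s} c k) i) ⟩
    (lift (step k s) i - lift s i) + (lift (track L (step k s)) i - lift (step k s) i)
      ≡⟨ ring (lift s i) (lift (step k s) i) (lift (track L (step k s)) i) ⟩
    lift (track L (step k s)) i - lift s i ∎
    where
    open ≡-Reasoning
    ring : ∀ x y z → (y - x) + (z - y) ≡ z - x
    ring = solve-∀

  start : Tracker
  start = tracker initial initial (λ _ → + 0)

  consistent-start : Consistent start
  consistent-start = (λ _ → refl) , (λ _ → refl)

  -- The displacement vector and the common final state fix the lifted final positions,
  -- hence the final potentials, hence (by potential-track) all signed crossing numbers.
  signedCrossings-of-DV : ∀ (π : Permutation′ N) {L L′} → IsLadderOf π L → IsLadderOf π L′ → DV L ≡ DV L′ →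
    ∀ i j → i ≢ j → signedCrossings (events L initial) i j ≡ signedCrossings (events L′ initial) i j
  signedCrossings-of-DV π {L} {L′} isL isL′ sameDV i j i≢j =
    ∙-cancelˡ (potential start i j) _ _ (begin
      potential start i j + signedCrossings (events L initial) i j  ≡⟨ potential-track L start consistent-start i j i≢j ⟨
      potential E i j                                               ≡⟨ same-potential ⟩
      potential E′ i j                                              ≡⟨ potential-track L′ start consistent-start i j i≢j ⟩
      potential start i j + signedCrossings (events L′ initial) i j ∎)
    where
    open ≡-Reasoning
    E = track L start
    E′ = track L′ start
    cE′ = consistent-track L′ start consistent-start
    same-ρ : ∀ x → ρ E x ≡ ρ E′ x
    same-ρ x = TrackerStep.σ-injective {E′} cE′ (begin
      σ E′ (ρ E x)          ≡⟨ cong (λ f → f (ρ E x)) (σ-track L′ start) ⟩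
      run L′ initial (ρ E x) ≡⟨ trans (isL′ (ρ E x)) (sym (isL (ρ E x))) ⟩
      run L initial (ρ E x)  ≡⟨ cong (λ f → f (ρ E x)) (σ-track L start) ⟨
      σ E (ρ E x)            ≡⟨ proj₂ (consistent-track L start consistent-start) x ⟩
      x                      ≡⟨ proj₂ cE′ x ⟨
      σ E′ (ρ E′ x)          ∎)
    same-lift : ∀ x → lift E x ≡ lift E′ x
    same-lift x = ∙-cancelʳ (- lift start x) _ _ (begin
      lift E x - lift start x              ≡⟨ dispE-track L start consistent-start x ⟨
      dispE (events L initial) x           ≡⟨ VP.lookup∘tabulate (dispE (events L initial)) x ⟨
      lookup (DV L) x                      ≡⟨ cong (λ v → lookup v x) sameDV ⟩
      lookup (DV L′) x                     ≡⟨ VP.lookup∘tabulate (dispE (events L′ initial)) x ⟩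
      dispE (events L′ initial) x          ≡⟨ dispE-track L′ start consistent-start x ⟩
      lift E′ x - lift start x             ∎)
    same-W : ∀ x → W E x ≡ W E′ x
    same-W x = ℤP.*-cancelˡ-≡ (+ N) _ _ (∙-cancelˡ (+ toℕ (ρ E′ x)) _ _
                 (subst (λ p → + toℕ p + + N * W E x ≡ lift E′ x) (same-ρ x) (same-lift x)))
    same-potential : potential E i j ≡ potential E′ i j
    same-potential = cong₂ _-_ (cong₂ _-_ (same-W i) (same-W j)) (cong₂ before (same-ρ i) (same-ρ j))

  braidReachable-of-DV : ∀ (π : Permutation′ N) {L L′} → InL1 π L → InL1 π L′ → DV L ≡ DV L′ → BraidReachable L L′
  braidReachable-of-DV π {L} {L′} (isL , once) (isL′ , once′) sameDV =
    Star.map as-step (reachable-of-signedCrossings (length L) L L′ start consistent-start ℕP.≤-refl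
                       once once′ (signedCrossings-of-DV π {L} {L′} isL isL′ sameDV))
    where
    as-step : ∀ {A B} → Move A B → Step A B
    as-step (inj₁ c) = inj₁ (commute-crossSeqE initial (λ e → e) c)
    as-step (inj₂ b) = inj₂ b

  dispE-of-braidReachable : ∀ {L L′ : Ladder N} → BraidReachable L L′ → ∀ i →
                            dispE (events L initial) i ≡ dispE (events L′ initial) i
  dispE-of-braidReachable ε i = refl
  dispE-of-braidReachable {L} (_◅_ {j = M} (inj₁ same) r) i =
    trans (dispE-of-crossSeqE (length L) L M initial (λ e → e) ℕP.≤-refl same i) (dispE-of-braidReachable r i)
  dispE-of-braidReachable (inj₂ b ◅ r) i =
    trans (displacement (sameCounts (move-preserves initial (inj₂ b))) i) (dispE-of-braidReachable r i)

theorem1 : (n : ℕ) → 3 ≤ n → (π : Permutation′ n) → (L L′ : Ladder n) →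
    InL1 π L → InL1 π L′ → (DV L ≡ DV L′) ⇔ BraidReachable L L′
theorem1 (suc m) (s≤s 2≤m) π L L′ inL1 inL1′ =
  mk⇔ (braidReachable-of-DV π {L} {L′} inL1 inL1′) (λ r → VP.tabulate-cong (dispE-of-braidReachable {L} {L′} r))
  where open Cylinder m 2≤m
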